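{- Let $q$ be a prime power and $(u_1,v_1,\dots,u_5,v_5)$ a tuple over $\mathbb{F}_q^*$. In $\Lambda_{5,q}$ there is a cycle of type $(u_1,v_1,\dots,u_5,v_5)$ if and only if there exist $a,b,c,d,r\in\mathbb{F}_q^*$ with $ca^2+c(2b+c)a+b(c+d)(b+c+d)=0$ and $a+b+c+d\ne0$ such that $v_1=a$, $v_2=b$, $v_3=c$, $v_4=d$, $v_5=-(a+b+c+d)$ and $u_1=cr$, $u_2=dr$, $u_3=-(a+b+c+d)r$, $u_4=ar$, $u_5=br$.
   Context: For a prime power $q$ and integer $k\ge2$, $\Lambda_{k,q}$ is the bipartite graph with vertex set $L_k\cup R_k$ (regarded as disjoint), where $L_k$ is the set of vectors $[l]=(l_0,\dots,l_k)\in\mathbb{F}_q^{k+1}$ with $l_1=l_2$ and $R_k$ the set of vectors $\langle r\rangle=(r_0,\dots,r_k)\in\mathbb{F}_q^{k+1}$ with $r_1=0$; edges join only $L_k$ to $R_k$, and $[l]\sim\langle r\rangle$ iff for every $2\le i\le k$: $l_i+r_i=r_0l_{i-2}$ if $i\equiv2,3\pmod4$, and $l_i+r_i=l_0r_{i-2}$ if $i\equiv0,1\pmod4$. A cycle of length $2n$ through the edge joining the two all-zero vectors is written $[l^{(1)}],\langle r^{(1)}\rangle,\dots,[l^{(n)}],\langle r^{(n)}\rangle$ (distinct vertices, consecutive ones adjacent, $\langle r^{(n)}\rangle\sim[l^{(1)}]$) with $[l^{(1)}]$ and $\langle r^{(1)}\rangle$ the all-zero vectors. Put $x_i=l^{(i)}_0$,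 $y_i=r^{(i)}_0$ ($1\le i\le n$), $x_{n+1}=y_{n+1}=0$, $u_i=x_{i+1}-x_i$, $v_i=y_{i+1}-y_i$; the tuple $(u_1,v_1,\dots,u_n,v_n)$ is the type of the cycle, and "there is a cycle of type $\epsilon$" means such a cycle with type $\epsilon$ exists. -}

module Defs where

open import Level using (0ℓ)
open import Data.Nat using (ℕ; zero; suc; _≤_; _<?_; _%_; _∸_)
open import Data.Nat.Primality using (Prime)
open import Data.Fin using (Fin; zero; suc; toℕ; fromℕ; fromℕ<; inject₁)
open import Data.Product using (Σ; ∃; _×_; _,_)
open import Relation.Nullary using (¬_; yes; no)
open import Relation.Binary.PropositionalEquality using (_≡_)
open import Algebra.Bundles using (CommutativeRing)

IsPrimePower : ℕ → Set
IsPrimePower q = Σ ℕ λ p → Σ ℕ λ k → Prime p × (1 ≤ k) × (q ≡ p Data.Nat.^ k)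

record FiniteField (q : ℕ) : Set₁ where
  field
    ring : CommutativeRing 0ℓ 0ℓ
  open CommutativeRing ring
  field
    1≉0       : ¬ (1# ≈ 0#)
    inverse   : ∀ x → ¬ (x ≈ 0#) → ∃ λ y → (x * y) ≈ 1#
    enum      : Fin q → Carrier
    enum-inj  : ∀ i j → enum i ≈ enum j → i ≡ j
    enum-surj : ∀ x → ∃ λ i → enum i ≈ x

module Lambda {q : ℕ} (F : FiniteField q) where
  open FiniteField F
  open CommutativeRing ring public
    using (Carrier; _≈_; _+_; _*_; -_; _-_; 0#; 1#)

  NonZero : Carrier → Set
  NonZero x = ¬ (x ≈ 0#)

  Vect : ℕ → Set
  Vect k = Fin (suc k) → Carrier

  -- coordinate access by a natural-number index (only used for indices ≤ k)
  coord : ∀ {k} → Vect k → ℕ → Carrier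
  coord {k} v i with i <? suc k
  ... | yes p = v (fromℕ< p)
  ... | no _  = 0#

  -- vertex sets (k ≥ 2 so indices 1,2 exist)
  InL : ∀ k → Vect k → Set
  InL k l = coord l 1 ≈ coord l 2

  InR : ∀ k → Vect k → Set
  InR k r = coord r 1 ≈ 0#

  ByResidue : ℕ → Set → Set → Set
  ByResidue 2 A B = A
  ByResidue 3 A B = A
  ByResidue _ A B = B

  Adj : ∀ k → Vect k → Vect k → Set
  Adj k l r = ∀ (i : Fin (suc k)) → 2 ≤ toℕ i →
    ByResidue (toℕ i % 4)
      ((l i + r i) ≈ (coord r 0 * coord l (toℕ i ∸ 2)))
      ((l i + r i) ≈ (coord l 0 * coord r (toℕ i ∸ 2)))

  _≋_ : ∀ {k} → Vect k → Vect k → Set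
  v ≋ w = ∀ i → v i ≈ w i

  zeroVec : ∀ {k} → Vect k
  zeroVec _ = 0#

  extend : ∀ {n} → (Fin n → Carrier) → Fin (suc n) → Carrier
  extend {zero}  f zero    = 0#
  extend {suc n} f zero    = f zero
  extend {suc n} f (suc j) = extend (λ t → f (suc t)) j

  diffs : ∀ {n} → (Fin n → Carrier) → Fin n → Carrier
  diffs f i = extend f (suc i) - extend f (inject₁ i)

  -- A cycle of length 2(m+1) in Λ_{k,q} through the edge joining the two
  -- all-zero vectors:  [l⁽¹⁾],⟨r⁽¹⁾⟩,…,[l⁽ⁿ⁾],⟨r⁽ⁿ⁾⟩  with n = m+1, indexed by Fin n.
  record Cycle (k m : ℕ) : Set where
    field
      l : Fin (suc m) → Vect k
      r : Fin (suc m) → Vect k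
      l∈L : ∀ i → InL k (l i)
      r∈R : ∀ i → InR k (r i)
      l-first : l zero ≋ zeroVec
      r-first : r zero ≋ zeroVec
      l-distinct : ∀ i j → l i ≋ l j → i ≡ j
      r-distinct : ∀ i j → r i ≋ r j → i ≡ j
      adj-lr : ∀ i → Adj k (l i) (r i)
      adj-rl : ∀ (i : Fin m) → Adj k (l (suc i)) (r (inject₁ i))
      adj-close : Adj k (l zero) (r (fromℕ m))
    -- x_i = l⁽ⁱ⁾_0, y_i = r⁽ⁱ⁾_0 ; type (u_1,v_1,…,u_n,v_n)
    u : Fin (suc m) → Carrier
    u = diffs (λ i → l i zero)
    v : Fin (suc m) → Carrier
    v = diffs (λ i → r i zero)

  HasCycleOfType : ∀ k m → (Fin (suc m) → Carrier) → (Fin (suc m) → Carrier) → Set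
  HasCycleOfType k m us vs = Σ (Cycle k m) λ C →
    (∀ i → Cycle.u C i ≈ us i) × (∀ i → Cycle.v C i ≈ vs i)

{-# OPTIONS --safe #-}
-- Adjacency in Λ₅ determines each vertex from its predecessor and its 0-coordinate, so a
-- 10-cycle through the zero edge is the path determined by x₁, …, x₄, y₁, …, y₄, and it closes
-- up iff coordinates 2, …, 5 of its last vertex vanish.  Multiplied by suitable nonzero products
-- of entries of the type, each of u₀v₃ − u₁v₂, u₁v₄ − u₂v₃, u₂v₀ − u₃v₄, u₃v₁ − u₄v₀ and the
-- closing polynomial of v is an explicit combination of these four coordinates.  Hence u i is
-- r · v (i + 2) (indices mod 5).  Conversely, for a parametrised type the four coordinates are
-- multiples of the closing polynomial, and any two vertices on the same side differ in some
-- coordinate by a nonzero product of the parameters.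
module Submission where

open import Defs
open import Data.Nat using (ℕ)
open import Data.Fin using (Fin; zero; suc)
open import Data.Product using (Σ; _×_; _,_)
open import Relation.Nullary using (¬_)
open import Function.Bundles using (_⇔_)

open import Level using (0ℓ; _⊔_)
open import Algebra.Bundles using (CommutativeRing; RawRing)
open import Data.Bool using (Bool; true; false)
open import Data.Empty using (⊥-elim)
open import Data.Fin using (_<_; inject₁)
open import Data.Fin.Properties using (<-cmp)
open import Data.Maybe using (nothing)
open import Data.Nat as ℕ using (_≤_; z≤n; s≤s)
open import Data.Product using (∃; proj₁; proj₂)
open import Data.Vec using (Vec)
open import Function.Bundles using (mk⇔)
open import Relation.Binary.Definitions using (tri<; tri≈; tri>)
import Relation.Binary.PropositionalEquality as ≡

pattern 𝟎 = zero
pattern 𝟏 = suc 𝟎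
pattern 𝟐 = suc 𝟏
pattern 𝟑 = suc 𝟐
pattern 𝟒 = suc 𝟑
pattern 𝟓 = suc 𝟒

-- The standard solver instantiated at the ring itself cannot decide that a coefficient such as
-- 1# - 1# is zero, so it fails on identities involving cancellation; integer coefficients fix this.
module DifferenceCoefficientSolver {c ℓ} (R : CommutativeRing c ℓ) where
  open CommutativeRing R
  open import Algebra.Properties.Ring ring using (-‿distribˡ-*; -‿distribʳ-*)
  open import Algebra.Properties.AbelianGroup +-abelianGroup
    using (⁻¹-involutive; ⁻¹-∙-comm; ⁻¹-anti-homo‿-; ε⁻¹≈ε)
  open import Algebra.Properties.CommutativeSemigroup +-commutativeSemigroup using (interchange)
  open import Algebra.Properties.Semiring.Mult semiring using (×-homo-+; ×1-homo-*)
    renaming (_×_ to _·_)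
  open import Algebra.Properties.Semiring.Exp.TCOptimised semiring using (^-congˡ)
  open import Relation.Binary.Reasoning.Setoid setoid
  open import Tactic.RingSolver.Core.AlmostCommutativeRing using (fromCommutativeRing)
  open import Tactic.RingSolver.Core.Polynomial.Parameters using (Homomorphism)
  open import Tactic.RingSolver.Core.Expression public using (Expr; Κ; _⊕_; _⊗_; ⊝_)
  open import Tactic.RingSolver.Core.Expression using (Ι; _⊛_; module Eval)

  -- The pair (a , b) stands for the integer a − b.
  Diff : Set
  Diff = ℕ × ℕ

  normalise : ℕ → ℕ → Diff
  normalise (ℕ.suc a) (ℕ.suc b) = normalise a b
  normalise a       b       = a , b

  diffRawRing : RawRing 0ℓ 0ℓ
  diffRawRing = record
    { Carrier = Diff
    ; _≈_     = ≡._≡_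
    ; _+_     = λ { (a , b) (a′ , b′) → normalise (a ℕ.+ a′) (b ℕ.+ b′) }
    ; _*_     = λ { (a , b) (a′ , b′) →
                    normalise (a ℕ.* a′ ℕ.+ b ℕ.* b′) (a ℕ.* b′ ℕ.+ b ℕ.* a′) }
    ; -_      = λ { (a , b) → b , a }
    ; 0#      = 0 , 0
    ; 1#      = 1 , 0
    }
  open RawRing diffRawRing using () renaming (_+_ to _+ᶜ_; _*_ to _*ᶜ_; -_ to -ᶜ_)

  isZero : Diff → Bool
  isZero (0 , 0) = true
  isZero _       = false

  -- Zero is sent to 0# itself, so that an expression built from Κ (0 , 0) evaluates
  -- to literally the same ring term as one built from 0#.
  ⟦_⟧ᶜ : Diff → Carrier
  ⟦ 0 , 0 ⟧ᶜ = 0#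
  ⟦ a , b ⟧ᶜ = a · 1# - b · 1#

  ⟦⟧ᶜ-difference : ∀ a b → ⟦ a , b ⟧ᶜ ≈ a · 1# - b · 1#
  ⟦⟧ᶜ-difference 0       0       = sym (-‿inverseʳ 0#)
  ⟦⟧ᶜ-difference 0       (ℕ.suc b) = refl
  ⟦⟧ᶜ-difference (ℕ.suc a) b       = refl

  -‿distrib-+ : ∀ x y → - (x + y) ≈ - x - y
  -‿distrib-+ x y = sym (⁻¹-∙-comm x y)

  +-cancelˡ-− : ∀ x y z → (x + y) - (x + z) ≈ y - z
  +-cancelˡ-− x y z = begin
    (x + y) - (x + z)    ≈⟨ +-congˡ (-‿distrib-+ x z) ⟩
    (x + y) + (- x - z)  ≈⟨ interchange x y (- x) (- z) ⟩
    (x - x) + (y - z)    ≈⟨ +-congʳ (-‿inverseʳ x) ⟩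
    0# + (y - z)         ≈⟨ +-identityˡ _ ⟩
    y - z                ∎

  +-−-interchange : ∀ a b c d → (a + c) - (b + d) ≈ (a - b) + (c - d)
  +-−-interchange a b c d = begin
    (a + c) - (b + d)    ≈⟨ +-congˡ (-‿distrib-+ b d) ⟩
    (a + c) + (- b - d)  ≈⟨ interchange a c (- b) (- d) ⟩
    (a - b) + (c - d)    ∎

  −-*-expand : ∀ a b c d → (a - b) * (c - d) ≈ (a * c + b * d) - (a * d + b * c)
  −-*-expand a b c d = begin
    (a - b) * (c - d)                          ≈⟨ distribʳ _ _ _ ⟩
    a * (c - d) + - b * (c - d)                ≈⟨ +-cong (distribˡ _ _ _) (distribˡ _ _ _) ⟩
    (a * c + a * - d) + (- b * c + - b * - d)  ≈⟨ +-cong (+-congˡ (sym (-‿distribʳ-* a d)))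
                                                         (+-cong (sym (-‿distribˡ-* b c)) -b*-d≈bd) ⟩
    (a * c - a * d) + (- (b * c) + b * d)      ≈⟨ +-congˡ (+-comm _ _) ⟩
    (a * c - a * d) + (b * d - b * c)          ≈⟨ interchange _ _ _ _ ⟩
    (a * c + b * d) + (- (a * d) - b * c)      ≈⟨ +-congˡ (-‿distrib-+ _ _) ⟨
    (a * c + b * d) - (a * d + b * c)          ∎
    where
    -b*-d≈bd : - b * - d ≈ b * d
    -b*-d≈bd = begin
      - b * - d    ≈⟨ -‿distribˡ-* b (- d) ⟨
      - (b * - d)  ≈⟨ -‿cong (-‿distribʳ-* b d) ⟨
      - - (b * d)  ≈⟨ ⁻¹-involutive _ ⟩
      b * d        ∎

  ⟦normalise⟧ : ∀ a b → ⟦ normalise a b ⟧ᶜ ≈ a · 1# - b · 1#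
  ⟦normalise⟧ (ℕ.suc a) (ℕ.suc b) = trans (⟦normalise⟧ a b) (sym (+-cancelˡ-− 1# (a · 1#) (b · 1#)))
  ⟦normalise⟧ 0       b       = ⟦⟧ᶜ-difference 0 b
  ⟦normalise⟧ (ℕ.suc a) 0       = ⟦⟧ᶜ-difference (ℕ.suc a) 0

  +-homo : ∀ x y → ⟦ x +ᶜ y ⟧ᶜ ≈ ⟦ x ⟧ᶜ + ⟦ y ⟧ᶜ
  +-homo (a , b) (a′ , b′) = begin
    ⟦ normalise (a ℕ.+ a′) (b ℕ.+ b′) ⟧ᶜ     ≈⟨ ⟦normalise⟧ (a ℕ.+ a′) (b ℕ.+ b′) ⟩
    (a ℕ.+ a′) · 1# - (b ℕ.+ b′) · 1#        ≈⟨ +-cong (×-homo-+ 1# a a′) (-‿cong (×-homo-+ 1# b b′)) ⟩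
    (a · 1# + a′ · 1#) - (b · 1# + b′ · 1#)  ≈⟨ +-−-interchange _ _ _ _ ⟩
    (a · 1# - b · 1#) + (a′ · 1# - b′ · 1#)  ≈⟨ +-cong (⟦⟧ᶜ-difference a b) (⟦⟧ᶜ-difference a′ b′) ⟨
    ⟦ a , b ⟧ᶜ + ⟦ a′ , b′ ⟧ᶜ                 ∎

  *-homo : ∀ x y → ⟦ x *ᶜ y ⟧ᶜ ≈ ⟦ x ⟧ᶜ * ⟦ y ⟧ᶜ
  *-homo (a , b) (a′ , b′) = begin
    ⟦ normalise (a ℕ.* a′ ℕ.+ b ℕ.* b′) (a ℕ.* b′ ℕ.+ b ℕ.* a′) ⟧ᶜ
      ≈⟨ ⟦normalise⟧ (a ℕ.* a′ ℕ.+ b ℕ.* b′) (a ℕ.* b′ ℕ.+ b ℕ.* a′) ⟩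
    (a ℕ.* a′ ℕ.+ b ℕ.* b′) · 1# - (a ℕ.* b′ ℕ.+ b ℕ.* a′) · 1#
      ≈⟨ +-cong (·-homo a a′ b b′) (-‿cong (·-homo a b′ b a′)) ⟩
    (a · 1# * (a′ · 1#) + b · 1# * (b′ · 1#)) - (a · 1# * (b′ · 1#) + b · 1# * (a′ · 1#))
      ≈⟨ −-*-expand _ _ _ _ ⟨
    (a · 1# - b · 1#) * (a′ · 1# - b′ · 1#)
      ≈⟨ *-cong (⟦⟧ᶜ-difference a b) (⟦⟧ᶜ-difference a′ b′) ⟨
    ⟦ a , b ⟧ᶜ * ⟦ a′ , b′ ⟧ᶜ
      ∎
    where
    ·-homo : ∀ m n p q → (m ℕ.* n ℕ.+ p ℕ.* q) · 1# ≈ m · 1# * (n · 1#) + p · 1# * (q · 1#)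
    ·-homo m n p q = trans (×-homo-+ 1# (m ℕ.* n) (p ℕ.* q)) (+-cong (×1-homo-* m n) (×1-homo-* p q))

  -‿homo : ∀ x → ⟦ -ᶜ x ⟧ᶜ ≈ - ⟦ x ⟧ᶜ
  -‿homo (a , b) = begin
    ⟦ b , a ⟧ᶜ             ≈⟨ ⟦⟧ᶜ-difference b a ⟩
    b · 1# - a · 1#        ≈⟨ ⁻¹-anti-homo‿- (a · 1#) (b · 1#) ⟨
    - (a · 1# - b · 1#)    ≈⟨ -‿cong (⟦⟧ᶜ-difference a b) ⟨
    - ⟦ a , b ⟧ᶜ           ∎

  homomorphism : Homomorphism 0ℓ 0ℓ c ℓ
  homomorphism = record
    { from          = record { rawRing = diffRawRing ; isZero = isZero }
    ; to            = fromCommutativeRing R (λ _ → nothing)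
    ; morphism      = record
      { ⟦_⟧    = ⟦_⟧ᶜ
      ; +-homo = +-homo
      ; *-homo = *-homo
      ; -‿homo = -‿homo
      ; 0-homo = refl
      ; 1-homo = trans (+-congʳ (+-identityʳ 1#)) (trans (+-congˡ ε⁻¹≈ε) (+-identityʳ 1#))
      }
    ; Zero-C⟶Zero-R = λ { (0 , 0) _ → refl }
    }

  open Eval rawRing ⟦_⟧ᶜ using (⟦_⟧)
  open import Tactic.RingSolver.Core.Polynomial.Base (Homomorphism.from homomorphism)
    using (Poly; _⊞_; _⊠_; ⊟_; _⊡_) renaming (κ to κₚ; ι to ιₚ)
  open import Tactic.RingSolver.Core.Polynomial.Semantics homomorphism using () renaming (⟦_⟧ to ⟦_⟧ₚ)
  open import Tactic.RingSolver.Core.Polynomial.Homomorphism homomorphism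
    using (κ-hom; ι-hom; ⊞-hom; ⊠-hom; ⊟-hom; ⊡-hom)

  norm : ∀ {n} → Expr Diff n → Poly n
  norm (Κ x)   = κₚ x
  norm (Ι x)   = ιₚ x
  norm (x ⊕ y) = norm x ⊞ norm y
  norm (x ⊗ y) = norm x ⊠ norm y
  norm (⊝ x)   = ⊟ norm x
  norm (x ⊛ i) = norm x ⊡ i

  ⟦_⇓⟧ : ∀ {n} → Expr Diff n → Vec Carrier n → Carrier
  ⟦ e ⇓⟧ = ⟦ norm e ⟧ₚ

  correct : ∀ {n} (e : Expr Diff n) ρ → ⟦ e ⇓⟧ ρ ≈ ⟦ e ⟧ ρ
  correct (Κ x)   ρ = κ-hom x ρ
  correct (Ι x)   ρ = ι-hom x ρ
  correct (x ⊕ y) ρ = trans (⊞-hom (norm x) (norm y) ρ) (+-cong (correct x ρ) (correct y ρ))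
  correct (x ⊗ y) ρ = trans (⊠-hom (norm x) (norm y) ρ) (*-cong (correct x ρ) (correct y ρ))
  correct (⊝ x)   ρ = trans (⊟-hom (norm x) ρ) (-‿cong (correct x ρ))
  correct (x ⊛ i) ρ = trans (⊡-hom (norm x) i ρ) (^-congˡ i (correct x ρ))

  open import Relation.Binary.Reflection setoid Ι ⟦_⟧ ⟦_⇓⟧ correct public using (solve; _⊜_)

  infixl 6 _⊖_

  _⊖_ : ∀ {n} → Expr Diff n → Expr Diff n → Expr Diff n
  x ⊖ y = x ⊕ ⊝ y

  κ : ∀ {n} → ℕ → Expr Diff n
  κ m = Κ (m , 0)

module NonZeroArithmetic {c ℓ} (R : CommutativeRing c ℓ) where
  open CommutativeRing R
  open import Algebra.Properties.Group +-group using (x∙y⁻¹≈ε⇒x≈y)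
  open import Relation.Binary.Reasoning.Setoid setoid
  open DifferenceCoefficientSolver R

  HasInverses : Set (c ⊔ ℓ)
  HasInverses = ∀ x → ¬ x ≈ 0# → ∃ λ y → x * y ≈ 1#

  module WithInverses (inverse : HasInverses) where

    x*y≈0⇒y≈0 : ∀ {x y} → ¬ x ≈ 0# → x * y ≈ 0# → y ≈ 0#
    x*y≈0⇒y≈0 {x} {y} x≉0 xy≈0 with inverse x x≉0
    ... | x⁻¹ , xx⁻¹≈1 = begin
      y              ≈⟨ *-identityˡ y ⟨
      1# * y         ≈⟨ *-congʳ xx⁻¹≈1 ⟨
      x * x⁻¹ * y    ≈⟨ solve 3 (λ x x⁻¹ y → x ⊗ x⁻¹ ⊗ y ⊜ x⁻¹ ⊗ (x ⊗ y)) refl x x⁻¹ y ⟩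
      x⁻¹ * (x * y)  ≈⟨ *-congˡ xy≈0 ⟩
      x⁻¹ * 0#       ≈⟨ zeroʳ x⁻¹ ⟩
      0#             ∎

    infixl 7 _*≉0_

    _*≉0_ : ∀ {x y} → ¬ x ≈ 0# → ¬ y ≈ 0# → ¬ x * y ≈ 0#
    (x≉0 *≉0 y≉0) xy≈0 = y≉0 (x*y≈0⇒y≈0 x≉0 xy≈0)

    x*[y-z]≈0⇒y≈z : ∀ {x y z} → ¬ x ≈ 0# → x * (y - z) ≈ 0# → y ≈ z
    x*[y-z]≈0⇒y≈z x≉0 eq = x∙y⁻¹≈ε⇒x≈y _ _ (x*y≈0⇒y≈0 x≉0 eq)

    proportional : ∀ {u w r u′ w′} → ¬ w ≈ 0# → u ≈ w * r → u * w′ ≈ u′ * w → u′ ≈ w′ * r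
    proportional {u} {w} {r} {u′} {w′} w≉0 u≈wr uw′≈u′w = x*[y-z]≈0⇒y≈z w≉0 (begin
      w * (u′ - w′ * r)    ≈⟨ solve 4 (λ w r u′ w′ → w ⊗ (u′ ⊖ w′ ⊗ r) ⊜ u′ ⊗ w ⊖ w ⊗ r ⊗ w′)
                                      refl w r u′ w′ ⟩
      u′ * w - w * r * w′  ≈⟨ +-cong (sym uw′≈u′w) (-‿cong (*-congʳ (sym u≈wr))) ⟩
      u * w′ - u * w′      ≈⟨ -‿inverseʳ (u * w′) ⟩
      0#                   ∎)

-- Written over bare operations so that it can be instantiated both in the field and in the
-- solver's syntax, where evaluation reproduces the field-level terms verbatim.
module Paths {A : Set} (add mul : A → A → A) (neg : A → A) (o : A) where
  private
    infixl 6 _⊞_ _⊟_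
    infixl 7 _⊠_
    infix  8 ⊟_
    _⊞_ _⊠_ _⊟_ : A → A → A
    _⊞_ = add
    _⊠_ = mul
    x ⊟ y = x ⊞ neg y
    ⊟_ : A → A
    ⊟_ = neg

  Point : Set
  Point = Fin 6 → A

  origin : Point
  origin _ = o

  -- The unique vertex of L₅ with 0-coordinate x adjacent to r, and dually.
  leftStep : A → Point → Point
  leftStep x r 𝟎 = x
  leftStep x r 𝟏 = r 𝟎 ⊠ x ⊟ r 𝟐
  leftStep x r 𝟐 = r 𝟎 ⊠ x ⊟ r 𝟐
  leftStep x r 𝟑 = r 𝟎 ⊠ (r 𝟎 ⊠ x ⊟ r 𝟐) ⊟ r 𝟑
  leftStep x r 𝟒 = x ⊠ r 𝟐 ⊟ r 𝟒
  leftStep x r 𝟓 = x ⊠ r 𝟑 ⊟ r 𝟓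

  rightStep : A → Point → Point
  rightStep y l 𝟎 = y
  rightStep y l 𝟏 = o
  rightStep y l 𝟐 = y ⊠ l 𝟎 ⊟ l 𝟐
  rightStep y l 𝟑 = y ⊠ l 𝟏 ⊟ l 𝟑
  rightStep y l 𝟒 = l 𝟎 ⊠ (y ⊠ l 𝟎 ⊟ l 𝟐) ⊟ l 𝟒
  rightStep y l 𝟓 = l 𝟎 ⊠ (y ⊠ l 𝟏 ⊟ l 𝟑) ⊟ l 𝟓

  -- At each index this computes to Defs.diffs of (0, w₁, w₂, w₃, w₄).
  differences : A → A → A → A → Fin 5 → A
  differences w₁ w₂ w₃ w₄ 𝟎 = w₁ ⊟ o
  differences w₁ w₂ w₃ w₄ 𝟏 = w₂ ⊟ w₁
  differences w₁ w₂ w₃ w₄ 𝟐 = w₃ ⊟ w₂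
  differences w₁ w₂ w₃ w₄ 𝟑 = w₄ ⊟ w₃
  differences w₁ w₂ w₃ w₄ 𝟒 = o ⊟ w₄

  closingPolynomial : A → A → A → A → A
  closingPolynomial a b c d = c ⊠ a ⊠ a ⊞ c ⊠ (b ⊞ b ⊞ c) ⊠ a ⊞ b ⊠ (c ⊞ d) ⊠ (b ⊞ c ⊞ d)

  module Path (x₁ x₂ x₃ x₄ y₁ y₂ y₃ y₄ : A) where
    private
      l₁ r₁ l₂ r₂ l₃ r₃ l₄ r₄ : Point
      l₁ = leftStep x₁ origin
      r₁ = rightStep y₁ l₁
      l₂ = leftStep x₂ r₁
      r₂ = rightStep y₂ l₂
      l₃ = leftStep x₃ r₂
      r₃ = rightStep y₃ l₃
      l₄ = leftStep x₄ r₃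
      r₄ = rightStep y₄ l₄

    left right : Fin 5 → Point
    left 𝟎  = origin
    left 𝟏  = l₁
    left 𝟐  = l₂
    left 𝟑  = l₃
    left 𝟒  = l₄
    right 𝟎 = origin
    right 𝟏 = r₁
    right 𝟐 = r₂
    right 𝟑 = r₃
    right 𝟒 = r₄

    end : Point
    end = right 𝟒

    u v : Fin 5 → A
    u = differences x₁ x₂ x₃ x₄
    v = differences y₁ y₂ y₃ y₄

  module PathOfType (u₀ u₁ u₂ u₃ v₀ v₁ v₂ v₃ : A) =
    Path u₀ (u₀ ⊞ u₁) (u₀ ⊞ u₁ ⊞ u₂) (u₀ ⊞ u₁ ⊞ u₂ ⊞ u₃) v₀ (v₀ ⊞ v₁) (v₀ ⊞ v₁ ⊞ v₂) (v₀ ⊞ v₁ ⊞ v₂ ⊞ v₃)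

  module ParametrisedPath (a b c d r : A) =
    PathOfType (c ⊠ r) (d ⊠ r) (⊟ (a ⊞ b ⊞ c ⊞ d) ⊠ r) (a ⊠ r) a b c d

module TenCycles {q : ℕ} (F : FiniteField q) where
  open FiniteField F using (ring; inverse)
  open Lambda F
  open CommutativeRing ring
    using (setoid; refl; sym; trans; +-cong; +-congˡ; +-congʳ; *-cong; *-congˡ; *-congʳ; -‿cong;
           -‿inverseʳ; +-identityˡ; *-identityʳ; zeroˡ; zeroʳ)
  open import Relation.Binary.Reasoning.Setoid setoid
  open DifferenceCoefficientSolver ring
  open NonZeroArithmetic ring
  open WithInverses inverse
  open Paths _+_ _*_ -_ 0#
  module Sym {n} = Paths {Expr Diff n} _⊕_ _⊗_ ⊝_ (Κ (0 , 0))

  a-b+b≈a : ∀ a b → a - b + b ≈ a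
  a-b+b≈a = solve 2 (λ a b → a ⊖ b ⊕ b ⊜ a) refl

  b+[a-b]≈a : ∀ a b → b + (a - b) ≈ a
  b+[a-b]≈a = solve 2 (λ a b → b ⊕ (a ⊖ b) ⊜ a) refl

  a+b≈c⇒a≈c-b : ∀ {a b c} → a + b ≈ c → a ≈ c - b
  a+b≈c⇒a≈c-b {a} {b} a+b≈c = trans (solve 2 (λ a b → a ⊜ a ⊕ b ⊖ b) refl a b) (+-congʳ a+b≈c)

  a+b≈c⇒b≈c-a : ∀ {a b c} → a + b ≈ c → b ≈ c - a
  a+b≈c⇒b≈c-a {a} {b} a+b≈c = trans (solve 2 (λ a b → b ⊜ a ⊕ b ⊖ a) refl a b) (+-congʳ a+b≈c)

  2≤2+n : ∀ {n} → 2 ≤ 2 ℕ.+ n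
  2≤2+n = s≤s (s≤s z≤n)

  leftStep-adjacent : ∀ x r → Adj 5 (leftStep x r) r
  leftStep-adjacent x r 𝟎 ()
  leftStep-adjacent x r 𝟏 (s≤s ())
  leftStep-adjacent x r 𝟐 _ = a-b+b≈a _ _
  leftStep-adjacent x r 𝟑 _ = a-b+b≈a _ _
  leftStep-adjacent x r 𝟒 _ = a-b+b≈a _ _
  leftStep-adjacent x r 𝟓 _ = a-b+b≈a _ _

  rightStep-adjacent : ∀ y l → Adj 5 l (rightStep y l)
  rightStep-adjacent y l 𝟎 ()
  rightStep-adjacent y l 𝟏 (s≤s ())
  rightStep-adjacent y l 𝟐 _ = b+[a-b]≈a _ _
  rightStep-adjacent y l 𝟑 _ = b+[a-b]≈a _ _
  rightStep-adjacent y l 𝟒 _ = b+[a-b]≈a _ _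
  rightStep-adjacent y l 𝟓 _ = b+[a-b]≈a _ _

  adjacent⇒≋leftStep : ∀ {l r r′} → InL 5 l → Adj 5 l r → r ≋ r′ → l ≋ leftStep (l 𝟎) r′
  adjacent⇒≋leftStep {l} {r} {r′} l₁≈l₂ adj r≋r′ = go
    where
    isolate : ∀ i {s t} → (l i + r i ≈ s) → s ≈ t → l i ≈ t - r′ i
    isolate i eq s≈t = trans (a+b≈c⇒a≈c-b eq) (+-cong s≈t (-‿cong (r≋r′ i)))
    coord₂ : l 𝟐 ≈ r′ 𝟎 * l 𝟎 - r′ 𝟐
    coord₂ = isolate 𝟐 (adj 𝟐 2≤2+n) (*-congʳ (r≋r′ 𝟎))
    go : l ≋ leftStep (l 𝟎) r′
    go 𝟎 = refl
    go 𝟏 = trans l₁≈l₂ coord₂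
    go 𝟐 = coord₂
    go 𝟑 = isolate 𝟑 (adj 𝟑 2≤2+n) (*-cong (r≋r′ 𝟎) (trans l₁≈l₂ coord₂))
    go 𝟒 = isolate 𝟒 (adj 𝟒 2≤2+n) (*-congˡ (r≋r′ 𝟐))
    go 𝟓 = isolate 𝟓 (adj 𝟓 2≤2+n) (*-congˡ (r≋r′ 𝟑))

  adjacent⇒≋rightStep : ∀ {l l′ r} → InR 5 r → Adj 5 l r → l ≋ l′ → r ≋ rightStep (r 𝟎) l′
  adjacent⇒≋rightStep {l} {l′} {r} r₁≈0 adj l≋l′ = go
    where
    isolate : ∀ i {s t} → (l i + r i ≈ s) → s ≈ t → r i ≈ t - l′ i
    isolate i eq s≈t = trans (a+b≈c⇒b≈c-a eq) (+-cong s≈t (-‿cong (l≋l′ i)))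
    coord₂ : r 𝟐 ≈ r 𝟎 * l′ 𝟎 - l′ 𝟐
    coord₂ = isolate 𝟐 (adj 𝟐 2≤2+n) (*-congˡ (l≋l′ 𝟎))
    coord₃ : r 𝟑 ≈ r 𝟎 * l′ 𝟏 - l′ 𝟑
    coord₃ = isolate 𝟑 (adj 𝟑 2≤2+n) (*-congˡ (l≋l′ 𝟏))
    go : r ≋ rightStep (r 𝟎) l′
    go 𝟎 = refl
    go 𝟏 = r₁≈0
    go 𝟐 = coord₂
    go 𝟑 = coord₃
    go 𝟒 = isolate 𝟒 (adj 𝟒 2≤2+n) (*-cong (l≋l′ 𝟎) coord₂)
    go 𝟓 = isolate 𝟓 (adj 𝟓 2≤2+n) (*-cong (l≋l′ 𝟎) coord₃)

  TailVanishes : Vect 5 → Set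
  TailVanishes r = r 𝟐 ≈ 0# × r 𝟑 ≈ 0# × r 𝟒 ≈ 0# × r 𝟓 ≈ 0#

  adjacent-zero⇒tail-vanishes : ∀ {l r} → l ≋ zeroVec → Adj 5 l r → TailVanishes r
  adjacent-zero⇒tail-vanishes {l} {r} l≈0 adj =
    vanishes (adj 𝟐 2≤2+n) (l≈0 𝟐) (trans (*-congˡ (l≈0 𝟎)) (zeroʳ _)) ,
    vanishes (adj 𝟑 2≤2+n) (l≈0 𝟑) (trans (*-congˡ (l≈0 𝟏)) (zeroʳ _)) ,
    vanishes (adj 𝟒 2≤2+n) (l≈0 𝟒) (trans (*-congʳ (l≈0 𝟎)) (zeroˡ _)) ,
    vanishes (adj 𝟓 2≤2+n) (l≈0 𝟓) (trans (*-congʳ (l≈0 𝟎)) (zeroˡ _))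
    where
    vanishes : ∀ {a b c} → a + b ≈ c → a ≈ 0# → c ≈ 0# → b ≈ 0#
    vanishes a+b≈c a≈0 c≈0 =
      trans (a+b≈c⇒b≈c-a a+b≈c) (trans (+-cong c≈0 (-‿cong a≈0)) (-‿inverseʳ 0#))

  tail-vanishes⇒adjacent-zero : ∀ {r} → TailVanishes r → Adj 5 zeroVec r
  tail-vanishes⇒adjacent-zero (r₂≈0 , r₃≈0 , r₄≈0 , r₅≈0) = adj
    where
    0+b≈c : ∀ {b c} → b ≈ 0# → c ≈ 0# → 0# + b ≈ c
    0+b≈c b≈0 c≈0 = trans (+-identityˡ _) (trans b≈0 (sym c≈0))
    adj : Adj 5 zeroVec _
    adj 𝟎 ()
    adj 𝟏 (s≤s ())
    adj 𝟐 _ = 0+b≈c r₂≈0 (zeroʳ _)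
    adj 𝟑 _ = 0+b≈c r₃≈0 (zeroʳ _)
    adj 𝟒 _ = 0+b≈c r₄≈0 (zeroˡ _)
    adj 𝟓 _ = 0+b≈c r₅≈0 (zeroˡ _)

  tail-vanishes-resp : ∀ {r r′} → r ≋ r′ → TailVanishes r → TailVanishes r′
  tail-vanishes-resp r≋r′ (r₂≈0 , r₃≈0 , r₄≈0 , r₅≈0) =
    trans (sym (r≋r′ 𝟐)) r₂≈0 , trans (sym (r≋r′ 𝟑)) r₃≈0 ,
    trans (sym (r≋r′ 𝟒)) r₄≈0 , trans (sym (r≋r′ 𝟓)) r₅≈0

  tail-vanishes⇒combination≈0 : ∀ {r} → TailVanishes r →
    ∀ {g₂ g₃ g₄ g₅} → g₂ * r 𝟐 + g₃ * r 𝟑 + g₄ * r 𝟒 + g₅ * r 𝟓 ≈ 0#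
  tail-vanishes⇒combination≈0 (r₂≈0 , r₃≈0 , r₄≈0 , r₅≈0) {g₂} {g₃} {g₄} {g₅} = begin
    g₂ * _ + g₃ * _ + g₄ * _ + g₅ * _   ≈⟨ +-cong (+-cong (+-cong (*-congˡ r₂≈0) (*-congˡ r₃≈0))
                                                          (*-congˡ r₄≈0)) (*-congˡ r₅≈0) ⟩
    g₂ * 0# + g₃ * 0# + g₄ * 0# + g₅ * 0#
      ≈⟨ solve 4 (λ g₂ g₃ g₄ g₅ → g₂ ⊗ κ 0 ⊕ g₃ ⊗ κ 0 ⊕ g₄ ⊗ κ 0 ⊕ g₅ ⊗ κ 0 ⊜ κ 0) refl g₂ g₃ g₄ g₅ ⟩
    0#                                   ∎

  extend-cong : ∀ {n} {f g : Fin n → Carrier} → (∀ i → f i ≈ g i) → ∀ i → extend f i ≈ extend g i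
  extend-cong {ℕ.zero}  f≈g 𝟎       = refl
  extend-cong {ℕ.suc n} f≈g 𝟎       = f≈g 𝟎
  extend-cong {ℕ.suc n} f≈g (suc i) = extend-cong (λ j → f≈g (suc j)) i

  diffs-cong : ∀ {n} {f g : Fin n → Carrier} → (∀ i → f i ≈ g i) → ∀ i → diffs f i ≈ diffs g i
  diffs-cong f≈g i = +-cong (extend-cong f≈g (suc i)) (-‿cong (extend-cong f≈g (inject₁ i)))

  module CycleAsPath (C : Cycle 5 4) where
    open Cycle C using (l; r; l∈L; r∈R; l-first; r-first; adj-lr; adj-rl; adj-close)
    open Path (l 𝟏 𝟎) (l 𝟐 𝟎) (l 𝟑 𝟎) (l 𝟒 𝟎) (r 𝟏 𝟎) (r 𝟐 𝟎) (r 𝟑 𝟎) (r 𝟒 𝟎) public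

    private
      l₁≋ : l 𝟏 ≋ left 𝟏
      l₁≋ = adjacent⇒≋leftStep (l∈L 𝟏) (adj-rl 𝟎) r-first
      r₁≋ : r 𝟏 ≋ right 𝟏
      r₁≋ = adjacent⇒≋rightStep (r∈R 𝟏) (adj-lr 𝟏) l₁≋
      l₂≋ : l 𝟐 ≋ left 𝟐
      l₂≋ = adjacent⇒≋leftStep (l∈L 𝟐) (adj-rl 𝟏) r₁≋
      r₂≋ : r 𝟐 ≋ right 𝟐
      r₂≋ = adjacent⇒≋rightStep (r∈R 𝟐) (adj-lr 𝟐) l₂≋
      l₃≋ : l 𝟑 ≋ left 𝟑
      l₃≋ = adjacent⇒≋leftStep (l∈L 𝟑) (adj-rl 𝟐) r₂≋
      r₃≋ : r 𝟑 ≋ right 𝟑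
      r₃≋ = adjacent⇒≋rightStep (r∈R 𝟑) (adj-lr 𝟑) l₃≋
      l₄≋ : l 𝟒 ≋ left 𝟒
      l₄≋ = adjacent⇒≋leftStep (l∈L 𝟒) (adj-rl 𝟑) r₃≋
      r₄≋ : r 𝟒 ≋ right 𝟒
      r₄≋ = adjacent⇒≋rightStep (r∈R 𝟒) (adj-lr 𝟒) l₄≋

      x≈ : ∀ i → l i 𝟎 ≈ left i 𝟎
      x≈ 𝟎 = l-first 𝟎
      x≈ 𝟏 = refl
      x≈ 𝟐 = refl
      x≈ 𝟑 = refl
      x≈ 𝟒 = refl

      y≈ : ∀ i → r i 𝟎 ≈ right i 𝟎
      y≈ 𝟎 = r-first 𝟎
      y≈ 𝟏 = refl
      y≈ 𝟐 = refl
      y≈ 𝟑 = refl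
      y≈ 𝟒 = refl

    closes : TailVanishes end
    closes = tail-vanishes-resp r₄≋ (adjacent-zero⇒tail-vanishes l-first adj-close)

    u-type : ∀ i → Cycle.u C i ≈ u i
    u-type 𝟎 = diffs-cong x≈ 𝟎
    u-type 𝟏 = diffs-cong x≈ 𝟏
    u-type 𝟐 = diffs-cong x≈ 𝟐
    u-type 𝟑 = diffs-cong x≈ 𝟑
    u-type 𝟒 = diffs-cong x≈ 𝟒

    v-type : ∀ i → Cycle.v C i ≈ v i
    v-type 𝟎 = diffs-cong y≈ 𝟎
    v-type 𝟏 = diffs-cong y≈ 𝟏
    v-type 𝟐 = diffs-cong y≈ 𝟐
    v-type 𝟑 = diffs-cong y≈ 𝟑
    v-type 𝟒 = diffs-cong y≈ 𝟒

  Separated : (Fin 5 → Vect 5) → Set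
  Separated f = ∀ {i j} → i < j → ¬ f i ≋ f j

  separated⇒injective : ∀ {f} → Separated f → ∀ i j → f i ≋ f j → i ≡.≡ j
  separated⇒injective sep i j fi≋fj with <-cmp i j
  ... | tri< i<j _ _ = ⊥-elim (sep i<j fi≋fj)
  ... | tri≈ _ i≡j _ = i≡j
  ... | tri> _ _ j<i = ⊥-elim (sep j<i (λ k → sym (fi≋fj k)))

  module _ {x₁ x₂ x₃ x₄ y₁ y₂ y₃ y₄ : Carrier} where
    open Path x₁ x₂ x₃ x₄ y₁ y₂ y₃ y₄

    closedPath⇒cycle : TailVanishes end → Separated left → Separated right → Cycle 5 4
    closedPath⇒cycle closes left-sep right-sep = record
      { l          = left
      ; r          = right
      ; l∈L        = λ { 𝟎 → refl ; 𝟏 → refl ; 𝟐 → refl ; 𝟑 → refl ; 𝟒 → refl }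
      ; r∈R        = λ { 𝟎 → refl ; 𝟏 → refl ; 𝟐 → refl ; 𝟑 → refl ; 𝟒 → refl }
      ; l-first    = λ _ → refl
      ; r-first    = λ _ → refl
      ; l-distinct = separated⇒injective left-sep
      ; r-distinct = separated⇒injective right-sep
      ; adj-lr     = λ { 𝟎 → tail-vanishes⇒adjacent-zero (refl , refl , refl , refl)
                       ; 𝟏 → rightStep-adjacent y₁ (left 𝟏)
                       ; 𝟐 → rightStep-adjacent y₂ (left 𝟐)
                       ; 𝟑 → rightStep-adjacent y₃ (left 𝟑)
                       ; 𝟒 → rightStep-adjacent y₄ (left 𝟒) }
      ; adj-rl     = λ { 𝟎 → leftStep-adjacent x₁ (right 𝟎)
                       ; 𝟏 → leftStep-adjacent x₂ (right 𝟏)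
                       ; 𝟐 → leftStep-adjacent x₃ (right 𝟐)
                       ; 𝟑 → leftStep-adjacent x₄ (right 𝟑) }
      ; adj-close  = tail-vanishes⇒adjacent-zero closes
      }

  TypeParametrisation : (u v : Fin 5 → Carrier) → Set
  TypeParametrisation u v =
    Σ Carrier λ a → Σ Carrier λ b → Σ Carrier λ c → Σ Carrier λ d → Σ Carrier λ r →
      NonZero a × NonZero b × NonZero c × NonZero d × NonZero r ×
      closingPolynomial a b c d ≈ 0# ×
      NonZero (a + b + c + d) ×
      v 𝟎 ≈ a × v 𝟏 ≈ b × v 𝟐 ≈ c × v 𝟑 ≈ d × v 𝟒 ≈ - (a + b + c + d) ×
      u 𝟎 ≈ c * r × u 𝟏 ≈ d * r × u 𝟐 ≈ - (a + b + c + d) * r × u 𝟑 ≈ a * r × u 𝟒 ≈ b * r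

  parametrisation-resp : ∀ {u u′ v v′} → (∀ i → u i ≈ u′ i) → (∀ i → v i ≈ v′ i) →
    TypeParametrisation u v → TypeParametrisation u′ v′
  parametrisation-resp u≈u′ v≈v′
    (a , b , c , d , r , a≉0 , b≉0 , c≉0 , d≉0 , r≉0 , K≈0 , s≉0 ,
     v₀≈ , v₁≈ , v₂≈ , v₃≈ , v₄≈ , u₀≈ , u₁≈ , u₂≈ , u₃≈ , u₄≈) =
    a , b , c , d , r , a≉0 , b≉0 , c≉0 , d≉0 , r≉0 , K≈0 , s≉0 ,
    moved v≈v′ v₀≈ , moved v≈v′ v₁≈ , moved v≈v′ v₂≈ , moved v≈v′ v₃≈ , moved v≈v′ v₄≈ ,
    moved u≈u′ u₀≈ , moved u≈u′ u₁≈ , moved u≈u′ u₂≈ , moved u≈u′ u₃≈ , moved u≈u′ u₄≈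
    where
    moved : ∀ {w w′ : Fin 5 → Carrier} {i t} → (∀ j → w j ≈ w′ j) → w i ≈ t → w′ i ≈ t
    moved {i = i} w≈w′ wᵢ≈t = trans (sym (w≈w′ i)) wᵢ≈t

  -- The four cross-multiplied ratios say u i / v (i + 2) is independent of i, with indices mod 5.
  ratios⇒parametrisation : ∀ {u v} → (∀ i → NonZero (u i)) → (∀ i → NonZero (v i)) →
    v 𝟒 ≈ - (v 𝟎 + v 𝟏 + v 𝟐 + v 𝟑) → closingPolynomial (v 𝟎) (v 𝟏) (v 𝟐) (v 𝟑) ≈ 0# →
    u 𝟎 * v 𝟑 ≈ u 𝟏 * v 𝟐 → u 𝟏 * v 𝟒 ≈ u 𝟐 * v 𝟑 → u 𝟐 * v 𝟎 ≈ u 𝟑 * v 𝟒 → u 𝟑 * v 𝟏 ≈ u 𝟒 * v 𝟎 →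
    TypeParametrisation u v
  ratios⇒parametrisation {u} {v} u≉0 v≉0 v₄≈-s K≈0 ratio₀ ratio₁ ratio₂ ratio₃ =
    v 𝟎 , v 𝟏 , v 𝟐 , v 𝟑 , r , v≉0 𝟎 , v≉0 𝟏 , v≉0 𝟐 , v≉0 𝟑 , r≉0 , K≈0 , s≉0 ,
    refl , refl , refl , refl , v₄≈-s , u₀≈ , u₁≈ , trans u₂≈ (*-congʳ v₄≈-s) , u₃≈ , u₄≈
    where
    w : Carrier
    w = proj₁ (inverse (v 𝟐) (v≉0 𝟐))
    r : Carrier
    r = u 𝟎 * w
    u₀≈ : u 𝟎 ≈ v 𝟐 * r
    u₀≈ = begin
      u 𝟎              ≈⟨ *-identityʳ (u 𝟎) ⟨
      u 𝟎 * 1#         ≈⟨ *-congˡ (proj₂ (inverse (v 𝟐) (v≉0 𝟐))) ⟨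
      u 𝟎 * (v 𝟐 * w)  ≈⟨ solve 3 (λ u₀ v₂ w → u₀ ⊗ (v₂ ⊗ w) ⊜ v₂ ⊗ (u₀ ⊗ w)) refl (u 𝟎) (v 𝟐) w ⟩
      v 𝟐 * r          ∎
    u₁≈ : u 𝟏 ≈ v 𝟑 * r
    u₁≈ = proportional (v≉0 𝟐) u₀≈ ratio₀
    u₂≈ : u 𝟐 ≈ v 𝟒 * r
    u₂≈ = proportional (v≉0 𝟑) u₁≈ ratio₁
    u₃≈ : u 𝟑 ≈ v 𝟎 * r
    u₃≈ = proportional (v≉0 𝟒) u₂≈ ratio₂
    u₄≈ : u 𝟒 ≈ v 𝟏 * r
    u₄≈ = proportional (v≉0 𝟎) u₃≈ ratio₃
    r≉0 : NonZero r
    r≉0 r≈0 = u≉0 𝟎 (trans u₀≈ (trans (*-congˡ r≈0) (zeroʳ _)))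
    s≉0 : NonZero (v 𝟎 + v 𝟏 + v 𝟐 + v 𝟑)
    s≉0 s≈0 = v≉0 𝟒 (trans v₄≈-s (trans (-‿cong s≈0) (solve 0 (⊝ κ 0 ⊜ κ 0) refl)))

  differences-telescope : ∀ w₁ w₂ w₃ w₄ → let δ = differences w₁ w₂ w₃ w₄ in
    δ 𝟒 ≈ - (δ 𝟎 + δ 𝟏 + δ 𝟐 + δ 𝟑)
  differences-telescope = solve 4 (λ w₁ w₂ w₃ w₄ → let δ = Sym.differences w₁ w₂ w₃ w₄ in
    δ 𝟒 ⊜ ⊝ (δ 𝟎 ⊕ δ 𝟏 ⊕ δ 𝟐 ⊕ δ 𝟑)) refl

  -- Each relation below is a nonzero multiple of an explicit combination of the closing
  -- equations, the coordinates 2, …, 5 of the last vertex of the path.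
  module ClosedPath {x₁ x₂ x₃ x₄ y₁ y₂ y₃ y₄ : Carrier} where
    open Path x₁ x₂ x₃ x₄ y₁ y₂ y₃ y₄

    module _ (closes : TailVanishes end)
             (u≉0 : ∀ i → NonZero (u i)) (v≉0 : ∀ i → NonZero (v i)) where

      u₀v₃≈u₁v₂ : u 𝟎 * v 𝟑 ≈ u 𝟏 * v 𝟐
      u₀v₃≈u₁v₂ = x*[y-z]≈0⇒y≈z (u≉0 𝟎 *≉0 v≉0 𝟎 *≉0 u≉0 𝟒 *≉0 v≉0 𝟒) (trans (solve 8
        (λ x₁ x₂ x₃ x₄ y₁ y₂ y₃ y₄ → let module P = Sym.Path x₁ x₂ x₃ x₄ y₁ y₂ y₃ y₄ in
          P.u 𝟎 ⊗ P.v 𝟎 ⊗ P.u 𝟒 ⊗ P.v 𝟒 ⊗ (P.u 𝟎 ⊗ P.v 𝟑 ⊖ P.u 𝟏 ⊗ P.v 𝟐) ⊜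
          (⊝ x₁ ⊗ x₂ ⊗ y₁ ⊗ y₃ ⊕ x₁ ⊗ x₂ ⊗ y₁ ⊗ y₁ ⊖ x₁ ⊗ x₁ ⊗ y₁ ⊗ y₂ ⊕ x₁ ⊗ x₁ ⊗ y₁ ⊗ y₄
            ⊖ x₁ ⊗ x₁ ⊗ y₁ ⊗ y₁ ⊕ x₂ ⊗ x₃ ⊗ y₁ ⊗ y₂ ⊖ x₂ ⊗ x₃ ⊗ y₁ ⊗ y₃ ⊕ x₂ ⊗ x₃ ⊗ y₂ ⊗ y₃
            ⊖ x₂ ⊗ x₃ ⊗ y₂ ⊗ y₂ ⊖ x₂ ⊗ x₄ ⊗ y₂ ⊗ y₃ ⊕ x₂ ⊗ x₄ ⊗ y₂ ⊗ y₂
            ⊕ κ 2 ⊗ x₃ ⊗ x₄ ⊗ y₂ ⊗ y₃ ⊖ x₃ ⊗ x₄ ⊗ y₂ ⊗ y₂ ⊖ x₃ ⊗ x₄ ⊗ y₃ ⊗ y₃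
            ⊖ κ 2 ⊗ x₃ ⊗ x₃ ⊗ y₂ ⊗ y₃ ⊕ x₃ ⊗ x₃ ⊗ y₂ ⊗ y₂ ⊕ x₃ ⊗ x₃ ⊗ y₃ ⊗ y₃) ⊗ P.end 𝟐
          ⊕ (x₁ ⊗ x₁ ⊗ y₁ ⊖ x₂ ⊗ x₄ ⊗ y₂ ⊕ x₂ ⊗ x₄ ⊗ y₃) ⊗ P.end 𝟑
          ⊕ (x₁ ⊗ y₁ ⊗ y₂ ⊖ x₂ ⊗ y₁ ⊗ y₂ ⊕ x₂ ⊗ y₁ ⊗ y₃ ⊕ x₃ ⊗ y₂ ⊗ y₃ ⊖ x₃ ⊗ y₃ ⊗ y₃
            ⊖ x₄ ⊗ y₂ ⊗ y₃ ⊕ x₄ ⊗ y₃ ⊗ y₃) ⊗ P.end 𝟒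
          ⊕ (⊝ x₁ ⊗ y₁ ⊕ x₂ ⊗ y₂ ⊖ x₂ ⊗ y₃ ⊖ x₃ ⊗ y₂ ⊕ x₃ ⊗ y₃ ⊕ x₄ ⊗ y₂ ⊖ x₄ ⊗ y₃) ⊗ P.end 𝟓)
        refl x₁ x₂ x₃ x₄ y₁ y₂ y₃ y₄) (tail-vanishes⇒combination≈0 {end} closes))

      u₁v₄≈u₂v₃ : u 𝟏 * v 𝟒 ≈ u 𝟐 * v 𝟑
      u₁v₄≈u₂v₃ = x*[y-z]≈0⇒y≈z (u≉0 𝟎 *≉0 v≉0 𝟎 *≉0 u≉0 𝟏 *≉0 v≉0 𝟏) (trans (solve 8
        (λ x₁ x₂ x₃ x₄ y₁ y₂ y₃ y₄ → let module P = Sym.Path x₁ x₂ x₃ x₄ y₁ y₂ y₃ y₄ in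
          P.u 𝟎 ⊗ P.v 𝟎 ⊗ P.u 𝟏 ⊗ P.v 𝟏 ⊗ (P.u 𝟏 ⊗ P.v 𝟒 ⊖ P.u 𝟐 ⊗ P.v 𝟑) ⊜
          (⊝ κ 2 ⊗ x₁ ⊗ x₂ ⊗ y₁ ⊗ y₂ ⊖ x₁ ⊗ x₂ ⊗ y₁ ⊗ y₄ ⊕ κ 2 ⊗ x₁ ⊗ x₂ ⊗ y₁ ⊗ y₁
            ⊕ x₁ ⊗ x₂ ⊗ y₂ ⊗ y₄ ⊕ κ 2 ⊗ x₁ ⊗ x₃ ⊗ y₁ ⊗ y₂ ⊖ x₁ ⊗ x₃ ⊗ y₁ ⊗ y₃
            ⊖ x₁ ⊗ x₃ ⊗ y₁ ⊗ y₄ ⊕ x₁ ⊗ x₃ ⊗ y₂ ⊗ y₃ ⊖ x₁ ⊗ x₃ ⊗ y₂ ⊗ y₄ ⊕ x₁ ⊗ x₃ ⊗ y₃ ⊗ y₄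
            ⊖ x₁ ⊗ x₃ ⊗ y₃ ⊗ y₃ ⊕ x₁ ⊗ x₄ ⊗ y₁ ⊗ y₃ ⊖ x₁ ⊗ x₄ ⊗ y₁ ⊗ y₁ ⊖ x₁ ⊗ x₄ ⊗ y₂ ⊗ y₃
            ⊕ x₁ ⊗ x₄ ⊗ y₂ ⊗ y₄ ⊖ x₁ ⊗ x₄ ⊗ y₃ ⊗ y₄ ⊕ x₁ ⊗ x₄ ⊗ y₃ ⊗ y₃ ⊕ x₁ ⊗ x₁ ⊗ y₁ ⊗ y₄
            ⊖ x₁ ⊗ x₁ ⊗ y₁ ⊗ y₁ ⊖ κ 2 ⊗ x₂ ⊗ x₃ ⊗ y₁ ⊗ y₂ ⊕ x₂ ⊗ x₃ ⊗ y₁ ⊗ y₃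
            ⊕ x₂ ⊗ x₃ ⊗ y₁ ⊗ y₄ ⊖ x₂ ⊗ x₃ ⊗ y₂ ⊗ y₃ ⊖ x₂ ⊗ x₃ ⊗ y₂ ⊗ y₄
            ⊕ κ 2 ⊗ x₂ ⊗ x₃ ⊗ y₂ ⊗ y₂ ⊖ x₂ ⊗ x₄ ⊗ y₁ ⊗ y₃ ⊕ x₂ ⊗ x₄ ⊗ y₁ ⊗ y₁
            ⊕ x₂ ⊗ x₄ ⊗ y₂ ⊗ y₃ ⊖ x₂ ⊗ x₄ ⊗ y₂ ⊗ y₂ ⊕ κ 2 ⊗ x₂ ⊗ x₂ ⊗ y₁ ⊗ y₂
            ⊖ x₂ ⊗ x₂ ⊗ y₁ ⊗ y₁ ⊖ x₂ ⊗ x₂ ⊗ y₂ ⊗ y₂ ⊖ x₃ ⊗ x₄ ⊗ y₂ ⊗ y₄ ⊕ x₃ ⊗ x₄ ⊗ y₂ ⊗ y₂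
            ⊕ x₃ ⊗ x₄ ⊗ y₃ ⊗ y₄ ⊖ x₃ ⊗ x₄ ⊗ y₃ ⊗ y₃ ⊕ x₃ ⊗ x₃ ⊗ y₂ ⊗ y₄ ⊖ x₃ ⊗ x₃ ⊗ y₂ ⊗ y₂
            ⊖ x₃ ⊗ x₃ ⊗ y₃ ⊗ y₄ ⊕ x₃ ⊗ x₃ ⊗ y₃ ⊗ y₃) ⊗ P.end 𝟐
          ⊕ (⊝ x₁ ⊗ x₃ ⊗ y₂ ⊕ x₁ ⊗ x₃ ⊗ y₃ ⊕ x₁ ⊗ x₄ ⊗ y₁ ⊖ x₂ ⊗ x₄ ⊗ y₁ ⊕ x₂ ⊗ x₄ ⊗ y₂
            ⊖ x₃ ⊗ x₄ ⊗ y₂ ⊕ x₃ ⊗ x₄ ⊗ y₃ ⊕ x₃ ⊗ x₃ ⊗ y₂ ⊖ x₃ ⊗ x₃ ⊗ y₃) ⊗ P.end 𝟑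
          ⊕ (x₁ ⊗ y₁ ⊗ y₁ ⊖ x₁ ⊗ y₂ ⊗ y₄ ⊖ x₂ ⊗ y₁ ⊗ y₁ ⊕ x₂ ⊗ y₂ ⊗ y₂ ⊕ x₃ ⊗ y₂ ⊗ y₄
            ⊖ x₃ ⊗ y₂ ⊗ y₂) ⊗ P.end 𝟒
          ⊕ (⊝ κ 2 ⊗ x₁ ⊗ y₁ ⊕ x₁ ⊗ y₂ ⊖ x₁ ⊗ y₃ ⊕ x₁ ⊗ y₄ ⊕ κ 2 ⊗ x₂ ⊗ y₁ ⊖ κ 2 ⊗ x₂ ⊗ y₂
            ⊕ x₃ ⊗ y₂ ⊖ x₃ ⊗ y₄) ⊗ P.end 𝟓)
        refl x₁ x₂ x₃ x₄ y₁ y₂ y₃ y₄) (tail-vanishes⇒combination≈0 {end} closes))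

      u₂v₀≈u₃v₄ : u 𝟐 * v 𝟎 ≈ u 𝟑 * v 𝟒
      u₂v₀≈u₃v₄ = x*[y-z]≈0⇒y≈z (u≉0 𝟎 *≉0 v≉0 𝟎 *≉0 u≉0 𝟏 *≉0 v≉0 𝟏) (trans (solve 8
        (λ x₁ x₂ x₃ x₄ y₁ y₂ y₃ y₄ → let module P = Sym.Path x₁ x₂ x₃ x₄ y₁ y₂ y₃ y₄ in
          P.u 𝟎 ⊗ P.v 𝟎 ⊗ P.u 𝟏 ⊗ P.v 𝟏 ⊗ (P.u 𝟐 ⊗ P.v 𝟎 ⊖ P.u 𝟑 ⊗ P.v 𝟒) ⊜
          (⊝ x₁ ⊗ x₂ ⊗ y₁ ⊗ y₂ ⊕ x₁ ⊗ x₂ ⊗ y₁ ⊗ y₁ ⊕ x₁ ⊗ x₃ ⊗ y₁ ⊗ y₂ ⊖ x₁ ⊗ x₃ ⊗ y₁ ⊗ y₃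
            ⊖ x₁ ⊗ x₃ ⊗ y₁ ⊗ y₄ ⊕ x₁ ⊗ x₃ ⊗ y₁ ⊗ y₁ ⊕ x₁ ⊗ x₄ ⊗ y₁ ⊗ y₃ ⊖ x₁ ⊗ x₄ ⊗ y₁ ⊗ y₁
            ⊖ x₁ ⊗ x₁ ⊗ y₁ ⊗ y₂ ⊕ x₂ ⊗ x₃ ⊗ y₁ ⊗ y₃ ⊕ x₂ ⊗ x₃ ⊗ y₁ ⊗ y₄ ⊖ x₂ ⊗ x₃ ⊗ y₁ ⊗ y₁
            ⊖ x₂ ⊗ x₃ ⊗ y₂ ⊗ y₃ ⊖ x₂ ⊗ x₃ ⊗ y₂ ⊗ y₄ ⊕ x₂ ⊗ x₃ ⊗ y₂ ⊗ y₂ ⊖ x₂ ⊗ x₄ ⊗ y₁ ⊗ y₂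
            ⊖ x₂ ⊗ x₄ ⊗ y₁ ⊗ y₃ ⊕ x₂ ⊗ x₄ ⊗ y₁ ⊗ y₁ ⊕ x₂ ⊗ x₄ ⊗ y₂ ⊗ y₃
            ⊕ κ 2 ⊗ x₂ ⊗ x₂ ⊗ y₁ ⊗ y₂ ⊖ x₂ ⊗ x₂ ⊗ y₁ ⊗ y₁ ⊖ x₂ ⊗ x₂ ⊗ y₂ ⊗ y₂
            ⊕ x₃ ⊗ x₄ ⊗ y₁ ⊗ y₂ ⊖ x₃ ⊗ x₄ ⊗ y₁ ⊗ y₃ ⊕ x₃ ⊗ x₄ ⊗ y₂ ⊗ y₃ ⊖ x₃ ⊗ x₄ ⊗ y₂ ⊗ y₄
            ⊕ x₃ ⊗ x₄ ⊗ y₃ ⊗ y₄ ⊖ x₃ ⊗ x₄ ⊗ y₃ ⊗ y₃ ⊖ x₃ ⊗ x₃ ⊗ y₁ ⊗ y₂ ⊕ x₃ ⊗ x₃ ⊗ y₁ ⊗ y₃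
            ⊖ x₃ ⊗ x₃ ⊗ y₂ ⊗ y₃ ⊕ x₃ ⊗ x₃ ⊗ y₂ ⊗ y₄ ⊖ x₃ ⊗ x₃ ⊗ y₃ ⊗ y₄ ⊕ x₃ ⊗ x₃ ⊗ y₃ ⊗ y₃) ⊗ P.end 𝟐
          ⊕ (x₁ ⊗ x₄ ⊗ y₁ ⊖ x₃ ⊗ x₄ ⊗ y₂ ⊕ x₃ ⊗ x₄ ⊗ y₃ ⊕ x₃ ⊗ x₃ ⊗ y₂ ⊖ x₃ ⊗ x₃ ⊗ y₃) ⊗ P.end 𝟑
          ⊕ (x₁ ⊗ y₁ ⊗ y₂ ⊖ x₂ ⊗ y₁ ⊗ y₂ ⊕ x₂ ⊗ y₂ ⊗ y₂ ⊖ x₃ ⊗ y₁ ⊗ y₃ ⊕ x₃ ⊗ y₂ ⊗ y₃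
            ⊕ x₃ ⊗ y₂ ⊗ y₄ ⊖ x₃ ⊗ y₂ ⊗ y₂ ⊕ x₄ ⊗ y₁ ⊗ y₃ ⊖ x₄ ⊗ y₂ ⊗ y₃) ⊗ P.end 𝟒
          ⊕ (⊝ κ 2 ⊗ x₁ ⊗ y₁ ⊕ x₂ ⊗ y₁ ⊖ x₂ ⊗ y₂ ⊕ x₃ ⊗ y₁ ⊖ x₃ ⊗ y₄ ⊖ x₄ ⊗ y₁ ⊕ x₄ ⊗ y₂) ⊗ P.end 𝟓)
        refl x₁ x₂ x₃ x₄ y₁ y₂ y₃ y₄) (tail-vanishes⇒combination≈0 {end} closes))

      u₃v₁≈u₄v₀ : u 𝟑 * v 𝟏 ≈ u 𝟒 * v 𝟎
      u₃v₁≈u₄v₀ = x*[y-z]≈0⇒y≈z (u≉0 𝟎 *≉0 v≉0 𝟎 *≉0 u≉0 𝟏 *≉0 v≉0 𝟒) (trans (solve 8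
        (λ x₁ x₂ x₃ x₄ y₁ y₂ y₃ y₄ → let module P = Sym.Path x₁ x₂ x₃ x₄ y₁ y₂ y₃ y₄ in
          P.u 𝟎 ⊗ P.v 𝟎 ⊗ P.u 𝟏 ⊗ P.v 𝟒 ⊗ (P.u 𝟑 ⊗ P.v 𝟏 ⊖ P.u 𝟒 ⊗ P.v 𝟎) ⊜
          ( x₁ ⊗ x₂ ⊗ y₁ ⊗ y₂ ⊖ κ 2 ⊗ x₁ ⊗ x₂ ⊗ y₁ ⊗ y₁ ⊖ x₁ ⊗ x₃ ⊗ y₁ ⊗ y₂ ⊕ x₁ ⊗ x₃ ⊗ y₁ ⊗ y₃
            ⊕ x₁ ⊗ x₃ ⊗ y₁ ⊗ y₄ ⊖ x₁ ⊗ x₄ ⊗ y₁ ⊗ y₃ ⊕ x₁ ⊗ x₄ ⊗ y₁ ⊗ y₁ ⊕ x₁ ⊗ x₁ ⊗ y₁ ⊗ y₂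
            ⊕ x₁ ⊗ x₁ ⊗ y₁ ⊗ y₁ ⊕ x₂ ⊗ x₃ ⊗ y₁ ⊗ y₂ ⊖ x₂ ⊗ x₃ ⊗ y₁ ⊗ y₃ ⊖ x₂ ⊗ x₃ ⊗ y₁ ⊗ y₄
            ⊕ x₂ ⊗ x₃ ⊗ y₂ ⊗ y₃ ⊕ x₂ ⊗ x₃ ⊗ y₂ ⊗ y₄ ⊖ x₂ ⊗ x₃ ⊗ y₂ ⊗ y₂ ⊕ x₂ ⊗ x₄ ⊗ y₁ ⊗ y₃
            ⊖ x₂ ⊗ x₄ ⊗ y₁ ⊗ y₁ ⊖ x₂ ⊗ x₄ ⊗ y₂ ⊗ y₃ ⊖ κ 2 ⊗ x₂ ⊗ x₂ ⊗ y₁ ⊗ y₂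
            ⊕ x₂ ⊗ x₂ ⊗ y₁ ⊗ y₁ ⊕ x₂ ⊗ x₂ ⊗ y₂ ⊗ y₂ ⊖ x₃ ⊗ x₄ ⊗ y₂ ⊗ y₃ ⊕ x₃ ⊗ x₄ ⊗ y₂ ⊗ y₄
            ⊖ x₃ ⊗ x₄ ⊗ y₃ ⊗ y₄ ⊕ x₃ ⊗ x₄ ⊗ y₃ ⊗ y₃ ⊕ x₃ ⊗ x₃ ⊗ y₂ ⊗ y₃ ⊖ x₃ ⊗ x₃ ⊗ y₂ ⊗ y₄
            ⊕ x₃ ⊗ x₃ ⊗ y₃ ⊗ y₄ ⊖ x₃ ⊗ x₃ ⊗ y₃ ⊗ y₃) ⊗ P.end 𝟐
          ⊕ (⊝ x₁ ⊗ x₄ ⊗ y₁ ⊕ x₂ ⊗ x₄ ⊗ y₁ ⊕ x₃ ⊗ x₄ ⊗ y₂ ⊖ x₃ ⊗ x₄ ⊗ y₃ ⊖ x₃ ⊗ x₃ ⊗ y₂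
            ⊕ x₃ ⊗ x₃ ⊗ y₃) ⊗ P.end 𝟑
          ⊕ (⊝ x₁ ⊗ y₁ ⊗ y₂ ⊖ x₁ ⊗ y₁ ⊗ y₁ ⊕ x₂ ⊗ y₁ ⊗ y₂ ⊕ x₂ ⊗ y₁ ⊗ y₁ ⊖ x₂ ⊗ y₂ ⊗ y₂
            ⊖ x₃ ⊗ y₂ ⊗ y₃ ⊖ x₃ ⊗ y₂ ⊗ y₄ ⊕ x₃ ⊗ y₂ ⊗ y₂ ⊕ x₄ ⊗ y₂ ⊗ y₃) ⊗ P.end 𝟒
          ⊕ (κ 2 ⊗ x₁ ⊗ y₁ ⊖ κ 2 ⊗ x₂ ⊗ y₁ ⊕ x₂ ⊗ y₂ ⊕ x₃ ⊗ y₄ ⊖ x₄ ⊗ y₂) ⊗ P.end 𝟓)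
        refl x₁ x₂ x₃ x₄ y₁ y₂ y₃ y₄) (tail-vanishes⇒combination≈0 {end} closes))

      closingPolynomial≈0 : closingPolynomial (v 𝟎) (v 𝟏) (v 𝟐) (v 𝟑) ≈ 0#
      closingPolynomial≈0 = x*y≈0⇒y≈0 (u≉0 𝟎 *≉0 v≉0 𝟎 *≉0 u≉0 𝟏 *≉0 u≉0 𝟑) (trans (solve 8
        (λ x₁ x₂ x₃ x₄ y₁ y₂ y₃ y₄ → let module P = Sym.Path x₁ x₂ x₃ x₄ y₁ y₂ y₃ y₄ in
          P.u 𝟎 ⊗ P.v 𝟎 ⊗ P.u 𝟏 ⊗ P.u 𝟑 ⊗ Sym.closingPolynomial (P.v 𝟎) (P.v 𝟏) (P.v 𝟐) (P.v 𝟑) ⊜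
          (⊝ κ 2 ⊗ x₁ ⊗ x₂ ⊗ y₁ ⊗ y₂ ⊗ y₄ ⊕ x₁ ⊗ x₂ ⊗ y₁ ⊗ y₂ ⊗ y₂ ⊕ x₁ ⊗ x₂ ⊗ y₁ ⊗ y₁ ⊗ y₂
            ⊕ κ 3 ⊗ x₁ ⊗ x₂ ⊗ y₁ ⊗ y₁ ⊗ y₄ ⊖ κ 3 ⊗ x₁ ⊗ x₂ ⊗ y₁ ⊗ y₁ ⊗ y₁
            ⊕ κ 4 ⊗ x₁ ⊗ x₃ ⊗ y₁ ⊗ y₂ ⊗ y₄ ⊖ x₁ ⊗ x₃ ⊗ y₁ ⊗ y₂ ⊗ y₂
            ⊖ κ 3 ⊗ x₁ ⊗ x₃ ⊗ y₁ ⊗ y₃ ⊗ y₄ ⊕ x₁ ⊗ x₃ ⊗ y₁ ⊗ y₃ ⊗ y₃ ⊖ x₁ ⊗ x₃ ⊗ y₁ ⊗ y₄ ⊗ y₄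
            ⊖ κ 3 ⊗ x₁ ⊗ x₃ ⊗ y₁ ⊗ y₁ ⊗ y₂ ⊕ κ 2 ⊗ x₁ ⊗ x₃ ⊗ y₁ ⊗ y₁ ⊗ y₃
            ⊕ x₁ ⊗ x₃ ⊗ y₁ ⊗ y₁ ⊗ y₄ ⊕ κ 2 ⊗ x₁ ⊗ x₄ ⊗ y₁ ⊗ y₃ ⊗ y₄ ⊖ x₁ ⊗ x₄ ⊗ y₁ ⊗ y₃ ⊗ y₃
            ⊖ x₁ ⊗ x₄ ⊗ y₁ ⊗ y₁ ⊗ y₃ ⊖ x₁ ⊗ x₄ ⊗ y₁ ⊗ y₁ ⊗ y₄ ⊕ x₁ ⊗ x₄ ⊗ y₁ ⊗ y₁ ⊗ y₁
            ⊖ x₁ ⊗ x₁ ⊗ y₁ ⊗ y₂ ⊗ y₄ ⊕ x₁ ⊗ x₁ ⊗ y₁ ⊗ y₂ ⊗ y₂ ⊕ x₁ ⊗ x₁ ⊗ y₁ ⊗ y₁ ⊗ y₂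
            ⊖ x₁ ⊗ x₁ ⊗ y₁ ⊗ y₁ ⊗ y₄ ⊕ x₁ ⊗ x₁ ⊗ y₁ ⊗ y₁ ⊗ y₁ ⊕ x₂ ⊗ x₃ ⊗ y₁ ⊗ y₂ ⊗ y₃
            ⊖ κ 3 ⊗ x₂ ⊗ x₃ ⊗ y₁ ⊗ y₂ ⊗ y₄ ⊖ x₂ ⊗ x₃ ⊗ y₁ ⊗ y₂ ⊗ y₂
            ⊕ κ 3 ⊗ x₂ ⊗ x₃ ⊗ y₁ ⊗ y₃ ⊗ y₄ ⊖ x₂ ⊗ x₃ ⊗ y₁ ⊗ y₃ ⊗ y₃ ⊕ x₂ ⊗ x₃ ⊗ y₁ ⊗ y₄ ⊗ y₄
            ⊕ κ 3 ⊗ x₂ ⊗ x₃ ⊗ y₁ ⊗ y₁ ⊗ y₂ ⊖ κ 2 ⊗ x₂ ⊗ x₃ ⊗ y₁ ⊗ y₁ ⊗ y₃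
            ⊖ x₂ ⊗ x₃ ⊗ y₁ ⊗ y₁ ⊗ y₄ ⊖ κ 2 ⊗ x₂ ⊗ x₃ ⊗ y₂ ⊗ y₃ ⊗ y₄ ⊖ x₂ ⊗ x₃ ⊗ y₂ ⊗ y₄ ⊗ y₄
            ⊕ x₂ ⊗ x₃ ⊗ y₂ ⊗ y₂ ⊗ y₃ ⊕ κ 3 ⊗ x₂ ⊗ x₃ ⊗ y₂ ⊗ y₂ ⊗ y₄ ⊖ x₂ ⊗ x₃ ⊗ y₂ ⊗ y₂ ⊗ y₂
            ⊖ x₂ ⊗ x₄ ⊗ y₁ ⊗ y₂ ⊗ y₃ ⊕ x₂ ⊗ x₄ ⊗ y₁ ⊗ y₂ ⊗ y₂ ⊖ κ 2 ⊗ x₂ ⊗ x₄ ⊗ y₁ ⊗ y₃ ⊗ y₄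
            ⊕ x₂ ⊗ x₄ ⊗ y₁ ⊗ y₃ ⊗ y₃ ⊕ x₂ ⊗ x₄ ⊗ y₁ ⊗ y₁ ⊗ y₃ ⊕ x₂ ⊗ x₄ ⊗ y₁ ⊗ y₁ ⊗ y₄
            ⊖ x₂ ⊗ x₄ ⊗ y₁ ⊗ y₁ ⊗ y₁ ⊕ x₂ ⊗ x₄ ⊗ y₂ ⊗ y₃ ⊗ y₄ ⊖ x₂ ⊗ x₄ ⊗ y₂ ⊗ y₂ ⊗ y₂
            ⊕ κ 3 ⊗ x₂ ⊗ x₂ ⊗ y₁ ⊗ y₂ ⊗ y₄ ⊖ x₂ ⊗ x₂ ⊗ y₁ ⊗ y₂ ⊗ y₂
            ⊖ κ 2 ⊗ x₂ ⊗ x₂ ⊗ y₁ ⊗ y₁ ⊗ y₂ ⊖ κ 2 ⊗ x₂ ⊗ x₂ ⊗ y₁ ⊗ y₁ ⊗ y₄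
            ⊕ κ 2 ⊗ x₂ ⊗ x₂ ⊗ y₁ ⊗ y₁ ⊗ y₁ ⊖ x₂ ⊗ x₂ ⊗ y₂ ⊗ y₂ ⊗ y₄ ⊕ x₂ ⊗ x₂ ⊗ y₂ ⊗ y₂ ⊗ y₂
            ⊕ x₃ ⊗ x₄ ⊗ y₁ ⊗ y₂ ⊗ y₄ ⊖ x₃ ⊗ x₄ ⊗ y₁ ⊗ y₂ ⊗ y₂ ⊖ x₃ ⊗ x₄ ⊗ y₁ ⊗ y₃ ⊗ y₄
            ⊕ x₃ ⊗ x₄ ⊗ y₁ ⊗ y₃ ⊗ y₃ ⊖ x₃ ⊗ x₄ ⊗ y₂ ⊗ y₃ ⊗ y₄ ⊕ κ 2 ⊗ x₃ ⊗ x₄ ⊗ y₂ ⊗ y₃ ⊗ y₃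
            ⊖ x₃ ⊗ x₄ ⊗ y₂ ⊗ y₄ ⊗ y₄ ⊖ κ 2 ⊗ x₃ ⊗ x₄ ⊗ y₂ ⊗ y₂ ⊗ y₃ ⊕ x₃ ⊗ x₄ ⊗ y₂ ⊗ y₂ ⊗ y₄
            ⊕ x₃ ⊗ x₄ ⊗ y₂ ⊗ y₂ ⊗ y₂ ⊕ x₃ ⊗ x₄ ⊗ y₃ ⊗ y₄ ⊗ y₄ ⊖ x₃ ⊗ x₄ ⊗ y₃ ⊗ y₃ ⊗ y₃
            ⊖ x₃ ⊗ x₃ ⊗ y₁ ⊗ y₂ ⊗ y₄ ⊕ x₃ ⊗ x₃ ⊗ y₁ ⊗ y₂ ⊗ y₂ ⊕ x₃ ⊗ x₃ ⊗ y₁ ⊗ y₃ ⊗ y₄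
            ⊖ x₃ ⊗ x₃ ⊗ y₁ ⊗ y₃ ⊗ y₃ ⊕ κ 2 ⊗ x₃ ⊗ x₃ ⊗ y₂ ⊗ y₃ ⊗ y₄
            ⊖ κ 2 ⊗ x₃ ⊗ x₃ ⊗ y₂ ⊗ y₃ ⊗ y₃ ⊕ x₃ ⊗ x₃ ⊗ y₂ ⊗ y₄ ⊗ y₄ ⊕ x₃ ⊗ x₃ ⊗ y₂ ⊗ y₂ ⊗ y₃
            ⊖ κ 2 ⊗ x₃ ⊗ x₃ ⊗ y₂ ⊗ y₂ ⊗ y₄ ⊖ x₃ ⊗ x₃ ⊗ y₃ ⊗ y₄ ⊗ y₄ ⊕ x₃ ⊗ x₃ ⊗ y₃ ⊗ y₃ ⊗ y₃) ⊗ P.end 𝟐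
          ⊕ (⊝ x₁ ⊗ x₂ ⊗ y₁ ⊗ y₂ ⊕ x₁ ⊗ x₂ ⊗ y₁ ⊗ y₁ ⊕ κ 2 ⊗ x₁ ⊗ x₃ ⊗ y₁ ⊗ y₂
            ⊖ κ 2 ⊗ x₁ ⊗ x₃ ⊗ y₁ ⊗ y₃ ⊕ x₁ ⊗ x₄ ⊗ y₁ ⊗ y₃ ⊖ x₁ ⊗ x₄ ⊗ y₁ ⊗ y₁
            ⊖ x₁ ⊗ x₁ ⊗ y₁ ⊗ y₂ ⊖ κ 2 ⊗ x₂ ⊗ x₃ ⊗ y₁ ⊗ y₂ ⊕ κ 2 ⊗ x₂ ⊗ x₃ ⊗ y₁ ⊗ y₃
            ⊖ x₂ ⊗ x₃ ⊗ y₂ ⊗ y₃ ⊕ x₂ ⊗ x₃ ⊗ y₂ ⊗ y₂ ⊖ x₂ ⊗ x₄ ⊗ y₁ ⊗ y₂ ⊖ x₂ ⊗ x₄ ⊗ y₁ ⊗ y₃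
            ⊕ x₂ ⊗ x₄ ⊗ y₁ ⊗ y₁ ⊕ x₂ ⊗ x₄ ⊗ y₂ ⊗ y₂ ⊕ κ 2 ⊗ x₂ ⊗ x₂ ⊗ y₁ ⊗ y₂
            ⊖ x₂ ⊗ x₂ ⊗ y₁ ⊗ y₁ ⊖ x₂ ⊗ x₂ ⊗ y₂ ⊗ y₂ ⊕ x₃ ⊗ x₄ ⊗ y₁ ⊗ y₂ ⊖ x₃ ⊗ x₄ ⊗ y₁ ⊗ y₃
            ⊖ x₃ ⊗ x₄ ⊗ y₂ ⊗ y₃ ⊕ x₃ ⊗ x₄ ⊗ y₃ ⊗ y₃ ⊖ x₃ ⊗ x₃ ⊗ y₁ ⊗ y₂ ⊕ x₃ ⊗ x₃ ⊗ y₁ ⊗ y₃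
            ⊕ κ 2 ⊗ x₃ ⊗ x₃ ⊗ y₂ ⊗ y₃ ⊕ x₃ ⊗ x₃ ⊗ y₂ ⊗ y₄ ⊖ x₃ ⊗ x₃ ⊗ y₂ ⊗ y₂
            ⊖ x₃ ⊗ x₃ ⊗ y₃ ⊗ y₄ ⊖ x₃ ⊗ x₃ ⊗ y₃ ⊗ y₃) ⊗ P.end 𝟑
          ⊕ (⊝ x₁ ⊗ y₁ ⊗ y₂ ⊗ y₂ ⊕ x₁ ⊗ y₁ ⊗ y₁ ⊗ y₄ ⊖ x₁ ⊗ y₁ ⊗ y₁ ⊗ y₁ ⊖ x₂ ⊗ y₁ ⊗ y₁ ⊗ y₄
            ⊕ x₂ ⊗ y₁ ⊗ y₁ ⊗ y₁ ⊖ x₃ ⊗ y₁ ⊗ y₂ ⊗ y₄ ⊕ x₃ ⊗ y₁ ⊗ y₂ ⊗ y₂ ⊕ x₃ ⊗ y₂ ⊗ y₃ ⊗ y₃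
            ⊕ x₃ ⊗ y₂ ⊗ y₄ ⊗ y₄ ⊖ x₃ ⊗ y₂ ⊗ y₂ ⊗ y₃ ⊖ x₃ ⊗ y₂ ⊗ y₂ ⊗ y₄ ⊖ x₄ ⊗ y₂ ⊗ y₃ ⊗ y₃
            ⊕ x₄ ⊗ y₂ ⊗ y₂ ⊗ y₃) ⊗ P.end 𝟒
          ⊕ (x₁ ⊗ y₁ ⊗ y₂ ⊖ κ 2 ⊗ x₁ ⊗ y₁ ⊗ y₄ ⊕ κ 2 ⊗ x₁ ⊗ y₁ ⊗ y₁ ⊕ x₂ ⊗ y₁ ⊗ y₂
            ⊕ κ 2 ⊗ x₂ ⊗ y₁ ⊗ y₄ ⊖ κ 2 ⊗ x₂ ⊗ y₁ ⊗ y₁ ⊖ x₂ ⊗ y₂ ⊗ y₄ ⊖ x₃ ⊗ y₁ ⊗ y₂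
            ⊕ x₃ ⊗ y₁ ⊗ y₄ ⊖ x₃ ⊗ y₂ ⊗ y₃ ⊕ x₃ ⊗ y₂ ⊗ y₄ ⊕ x₃ ⊗ y₂ ⊗ y₂ ⊖ x₃ ⊗ y₄ ⊗ y₄
            ⊕ x₄ ⊗ y₂ ⊗ y₃ ⊖ x₄ ⊗ y₂ ⊗ y₂) ⊗ P.end 𝟓)
        refl x₁ x₂ x₃ x₄ y₁ y₂ y₃ y₄) (tail-vanishes⇒combination≈0 {end} closes))

      closedPath⇒parametrisation : TypeParametrisation u v
      closedPath⇒parametrisation = ratios⇒parametrisation u≉0 v≉0
        (differences-telescope y₁ y₂ y₃ y₄) closingPolynomial≈0 u₀v₃≈u₁v₂ u₁v₄≈u₂v₃ u₂v₀≈u₃v₄ u₃v₁≈u₄v₀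

  differ-at : ∀ {p q : Vect 5} {m s} i → NonZero m → m ≈ s * (p i - q i) → ¬ p ≋ q
  differ-at {p} {q} {m} {s} i m≉0 m≈ p≋q = m≉0 (begin
    m                ≈⟨ m≈ ⟩
    s * (p i - q i)  ≈⟨ *-congˡ (+-congʳ (p≋q i)) ⟩
    s * (q i - q i)  ≈⟨ solve 2 (λ s x → s ⊗ (x ⊖ x) ⊜ κ 0) refl s (q i) ⟩
    0#               ∎)

  differ-at₂ : ∀ {p q : Vect 5} {m s s′} i j → NonZero m →
    m ≈ s * (p i - q i) + s′ * (p j - q j) → ¬ p ≋ q
  differ-at₂ {p} {q} {m} {s} {s′} i j m≉0 m≈ p≋q = m≉0 (begin
    m                                    ≈⟨ m≈ ⟩
    s * (p i - q i) + s′ * (p j - q j)   ≈⟨ +-cong (*-congˡ (+-congʳ (p≋q i))) (*-congˡ (+-congʳ (p≋q j))) ⟩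
    s * (q i - q i) + s′ * (q j - q j)   ≈⟨ solve 4 (λ s s′ x y → s ⊗ (x ⊖ x) ⊕ s′ ⊗ (y ⊖ y) ⊜ κ 0)
                                                   refl s s′ (q i) (q j) ⟩
    0#                                   ∎)

  leftₛ rightₛ : ∀ {n} → (a b c d r : Expr Diff n) → Fin 5 → Fin 6 → Expr Diff n
  leftₛ  = Sym.ParametrisedPath.left
  rightₛ = Sym.ParametrisedPath.right

  module ParametrisedCycle (a b c d r : Carrier) where
    open ParametrisedPath a b c d r

    closes : closingPolynomial a b c d ≈ 0# → TailVanishes end
    closes K≈0 =
      solve 5 (λ a b c d r → rightₛ a b c d r 𝟒 𝟐 ⊜ κ 0) refl a b c d r ,
      multiple (solve 5 (λ a b c d r → rightₛ a b c d r 𝟒 𝟑 ⊜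
        ⊝ r ⊗ Sym.closingPolynomial a b c d) refl a b c d r) ,
      multiple (solve 5 (λ a b c d r → rightₛ a b c d r 𝟒 𝟒 ⊜
        r ⊗ r ⊗ Sym.closingPolynomial a b c d) refl a b c d r) ,
      multiple (solve 5 (λ a b c d r → rightₛ a b c d r 𝟒 𝟓 ⊜
        (a ⊗ r ⊗ r ⊕ b ⊗ r ⊗ r) ⊗ Sym.closingPolynomial a b c d) refl a b c d r)
      where
      multiple : ∀ {x g} → x ≈ g * closingPolynomial a b c d → x ≈ 0#
      multiple x≈gK = trans x≈gK (trans (*-congˡ K≈0) (zeroʳ _))

    module _ (a≉0 : NonZero a) (b≉0 : NonZero b) (c≉0 : NonZero c) (d≉0 : NonZero d)
             (r≉0 : NonZero r) (s≉0 : NonZero (a + b + c + d)) where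

      left-separated : Separated left
      left-separated {_} {𝟎} ()
      left-separated {suc _} {𝟏} (s≤s ())
      left-separated {suc (suc _)} {𝟐} (s≤s (s≤s ()))
      left-separated {suc (suc (suc _))} {𝟑} (s≤s (s≤s (s≤s ())))
      left-separated {𝟒} {𝟒} (s≤s (s≤s (s≤s (s≤s ()))))
      left-separated {𝟎} {𝟏} _ = differ-at 𝟎 (c≉0 *≉0 r≉0) (solve 5 (λ a b c d r →
        c ⊗ r ⊜ ⊝ κ 1 ⊗ (leftₛ a b c d r 𝟎 𝟎 ⊖ leftₛ a b c d r 𝟏 𝟎)) refl a b c d r)
      left-separated {𝟎} {𝟐} _ = differ-at 𝟏 (a≉0 *≉0 d≉0 *≉0 r≉0) (solve 5 (λ a b c d r →
        a ⊗ d ⊗ r ⊜ ⊝ κ 1 ⊗ (leftₛ a b c d r 𝟎 𝟏 ⊖ leftₛ a b c d r 𝟐 𝟏)) refl a b c d r)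
      left-separated {𝟎} {𝟑} _ = differ-at₂ 𝟏 𝟎 (b≉0 *≉0 d≉0 *≉0 r≉0) (solve 5 (λ a b c d r →
        b ⊗ d ⊗ r ⊜ κ 1 ⊗ (leftₛ a b c d r 𝟎 𝟏 ⊖ leftₛ a b c d r 𝟑 𝟏)
                    ⊕ ⊝ (a ⊕ b ⊕ c) ⊗ (leftₛ a b c d r 𝟎 𝟎 ⊖ leftₛ a b c d r 𝟑 𝟎)) refl a b c d r)
      left-separated {𝟎} {𝟒} _ = differ-at 𝟎 (b≉0 *≉0 r≉0) (solve 5 (λ a b c d r →
        b ⊗ r ⊜ κ 1 ⊗ (leftₛ a b c d r 𝟎 𝟎 ⊖ leftₛ a b c d r 𝟒 𝟎)) refl a b c d r)
      left-separated {𝟏} {𝟐} _ = differ-at 𝟎 (d≉0 *≉0 r≉0) (solve 5 (λ a b c d r →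
        d ⊗ r ⊜ ⊝ κ 1 ⊗ (leftₛ a b c d r 𝟏 𝟎 ⊖ leftₛ a b c d r 𝟐 𝟎)) refl a b c d r)
      left-separated {𝟏} {𝟑} _ = differ-at₂ 𝟏 𝟎 (b≉0 *≉0 d≉0 *≉0 r≉0) (solve 5 (λ a b c d r →
        b ⊗ d ⊗ r ⊜ κ 1 ⊗ (leftₛ a b c d r 𝟏 𝟏 ⊖ leftₛ a b c d r 𝟑 𝟏)
                    ⊕ ⊝ (a ⊕ b) ⊗ (leftₛ a b c d r 𝟏 𝟎 ⊖ leftₛ a b c d r 𝟑 𝟎)) refl a b c d r)
      left-separated {𝟏} {𝟒} _ = differ-at 𝟏 (b≉0 *≉0 s≉0 *≉0 r≉0) (solve 5 (λ a b c d r →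
        b ⊗ (a ⊕ b ⊕ c ⊕ d) ⊗ r ⊜ κ 1 ⊗ (leftₛ a b c d r 𝟏 𝟏 ⊖ leftₛ a b c d r 𝟒 𝟏)) refl a b c d r)
      left-separated {𝟐} {𝟑} _ = differ-at 𝟎 (s≉0 *≉0 r≉0) (solve 5 (λ a b c d r →
        (a ⊕ b ⊕ c ⊕ d) ⊗ r ⊜ κ 1 ⊗ (leftₛ a b c d r 𝟐 𝟎 ⊖ leftₛ a b c d r 𝟑 𝟎)) refl a b c d r)
      left-separated {𝟐} {𝟒} _ = differ-at₂ 𝟎 𝟏 (a≉0 *≉0 c≉0 *≉0 r≉0) (solve 5 (λ a b c d r →
        a ⊗ c ⊗ r ⊜ (a ⊕ b) ⊗ (leftₛ a b c d r 𝟐 𝟎 ⊖ leftₛ a b c d r 𝟒 𝟎)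
                    ⊕ ⊝ κ 1 ⊗ (leftₛ a b c d r 𝟐 𝟏 ⊖ leftₛ a b c d r 𝟒 𝟏)) refl a b c d r)
      left-separated {𝟑} {𝟒} _ = differ-at 𝟎 (a≉0 *≉0 r≉0) (solve 5 (λ a b c d r →
        a ⊗ r ⊜ ⊝ κ 1 ⊗ (leftₛ a b c d r 𝟑 𝟎 ⊖ leftₛ a b c d r 𝟒 𝟎)) refl a b c d r)

      right-separated : Separated right
      right-separated {_} {𝟎} ()
      right-separated {suc _} {𝟏} (s≤s ())
      right-separated {suc (suc _)} {𝟐} (s≤s (s≤s ()))
      right-separated {suc (suc (suc _))} {𝟑} (s≤s (s≤s (s≤s ())))
      right-separated {𝟒} {𝟒} (s≤s (s≤s (s≤s (s≤s ()))))
      right-separated {𝟎} {𝟏} _ = differ-at 𝟎 a≉0 (solve 5 (λ a b c d r →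
        a ⊜ ⊝ κ 1 ⊗ (rightₛ a b c d r 𝟎 𝟎 ⊖ rightₛ a b c d r 𝟏 𝟎)) refl a b c d r)
      right-separated {𝟎} {𝟐} _ = differ-at 𝟑 (a≉0 *≉0 b≉0 *≉0 d≉0 *≉0 r≉0) (solve 5 (λ a b c d r →
        a ⊗ b ⊗ d ⊗ r ⊜ ⊝ κ 1 ⊗ (rightₛ a b c d r 𝟎 𝟑 ⊖ rightₛ a b c d r 𝟐 𝟑)) refl a b c d r)
      right-separated {𝟎} {𝟑} _ = differ-at 𝟐 (b≉0 *≉0 d≉0 *≉0 r≉0) (solve 5 (λ a b c d r →
        b ⊗ d ⊗ r ⊜ ⊝ κ 1 ⊗ (rightₛ a b c d r 𝟎 𝟐 ⊖ rightₛ a b c d r 𝟑 𝟐)) refl a b c d r)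
      right-separated {𝟎} {𝟒} _ = differ-at 𝟎 s≉0 (solve 5 (λ a b c d r →
        a ⊕ b ⊕ c ⊕ d ⊜ ⊝ κ 1 ⊗ (rightₛ a b c d r 𝟎 𝟎 ⊖ rightₛ a b c d r 𝟒 𝟎)) refl a b c d r)
      right-separated {𝟏} {𝟐} _ = differ-at 𝟎 b≉0 (solve 5 (λ a b c d r →
        b ⊜ ⊝ κ 1 ⊗ (rightₛ a b c d r 𝟏 𝟎 ⊖ rightₛ a b c d r 𝟐 𝟎)) refl a b c d r)
      right-separated {𝟏} {𝟑} _ = differ-at₂ 𝟎 𝟐 (b≉0 *≉0 s≉0 *≉0 r≉0) (solve 5 (λ a b c d r →
        b ⊗ (a ⊕ b ⊕ c ⊕ d) ⊗ r ⊜ ⊝ (a ⊗ r ⊕ b ⊗ r) ⊗ (rightₛ a b c d r 𝟏 𝟎 ⊖ rightₛ a b c d r 𝟑 𝟎)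
                                  ⊕ ⊝ κ 1 ⊗ (rightₛ a b c d r 𝟏 𝟐 ⊖ rightₛ a b c d r 𝟑 𝟐)) refl a b c d r)
      right-separated {𝟏} {𝟒} _ = differ-at 𝟐 (a≉0 *≉0 c≉0 *≉0 r≉0) (solve 5 (λ a b c d r →
        a ⊗ c ⊗ r ⊜ κ 1 ⊗ (rightₛ a b c d r 𝟏 𝟐 ⊖ rightₛ a b c d r 𝟒 𝟐)) refl a b c d r)
      right-separated {𝟐} {𝟑} _ = differ-at 𝟎 c≉0 (solve 5 (λ a b c d r →
        c ⊜ ⊝ κ 1 ⊗ (rightₛ a b c d r 𝟐 𝟎 ⊖ rightₛ a b c d r 𝟑 𝟎)) refl a b c d r)
      right-separated {𝟐} {𝟒} _ = differ-at₂ 𝟐 𝟎 (a≉0 *≉0 c≉0 *≉0 r≉0) (solve 5 (λ a b c d r →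
        a ⊗ c ⊗ r ⊜ κ 1 ⊗ (rightₛ a b c d r 𝟐 𝟐 ⊖ rightₛ a b c d r 𝟒 𝟐)
                    ⊕ b ⊗ r ⊗ (rightₛ a b c d r 𝟐 𝟎 ⊖ rightₛ a b c d r 𝟒 𝟎)) refl a b c d r)
      right-separated {𝟑} {𝟒} _ = differ-at 𝟎 d≉0 (solve 5 (λ a b c d r →
        d ⊜ ⊝ κ 1 ⊗ (rightₛ a b c d r 𝟑 𝟎 ⊖ rightₛ a b c d r 𝟒 𝟎)) refl a b c d r)

  uₛ vₛ : ∀ {n} → (a b c d r : Expr Diff n) → Fin 5 → Expr Diff n
  uₛ = Sym.ParametrisedPath.u
  vₛ = Sym.ParametrisedPath.v

  parametrisation⇒cycle : ∀ {U V} → TypeParametrisation U V → HasCycleOfType 5 4 U V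
  parametrisation⇒cycle {U} {V} (a , b , c , d , r , a≉0 , b≉0 , c≉0 , d≉0 , r≉0 , K≈0 , s≉0 ,
                                 v₀≈ , v₁≈ , v₂≈ , v₃≈ , v₄≈ , u₀≈ , u₁≈ , u₂≈ , u₃≈ , u₄≈) =
    cycle , u-type , v-type
    where
    open ParametrisedCycle a b c d r
    cycle : Cycle 5 4
    cycle = closedPath⇒cycle (closes K≈0)
      (left-separated a≉0 b≉0 c≉0 d≉0 r≉0 s≉0) (right-separated a≉0 b≉0 c≉0 d≉0 r≉0 s≉0)
    u-type : ∀ i → Cycle.u cycle i ≈ U i
    u-type 𝟎 = trans (solve 5 (λ a b c d r → uₛ a b c d r 𝟎 ⊜ c ⊗ r) refl a b c d r) (sym u₀≈)
    u-type 𝟏 = trans (solve 5 (λ a b c d r → uₛ a b c d r 𝟏 ⊜ d ⊗ r) refl a b c d r) (sym u₁≈)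
    u-type 𝟐 = trans (solve 5 (λ a b c d r → uₛ a b c d r 𝟐 ⊜ ⊝ (a ⊕ b ⊕ c ⊕ d) ⊗ r) refl a b c d r)
                     (sym u₂≈)
    u-type 𝟑 = trans (solve 5 (λ a b c d r → uₛ a b c d r 𝟑 ⊜ a ⊗ r) refl a b c d r) (sym u₃≈)
    u-type 𝟒 = trans (solve 5 (λ a b c d r → uₛ a b c d r 𝟒 ⊜ b ⊗ r) refl a b c d r) (sym u₄≈)
    v-type : ∀ i → Cycle.v cycle i ≈ V i
    v-type 𝟎 = trans (solve 5 (λ a b c d r → vₛ a b c d r 𝟎 ⊜ a) refl a b c d r) (sym v₀≈)
    v-type 𝟏 = trans (solve 5 (λ a b c d r → vₛ a b c d r 𝟏 ⊜ b) refl a b c d r) (sym v₁≈)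
    v-type 𝟐 = trans (solve 5 (λ a b c d r → vₛ a b c d r 𝟐 ⊜ c) refl a b c d r) (sym v₂≈)
    v-type 𝟑 = trans (solve 5 (λ a b c d r → vₛ a b c d r 𝟑 ⊜ d) refl a b c d r) (sym v₃≈)
    v-type 𝟒 = trans (solve 5 (λ a b c d r → vₛ a b c d r 𝟒 ⊜ ⊝ (a ⊕ b ⊕ c ⊕ d)) refl a b c d r)
                     (sym v₄≈)

  cycle⇒parametrisation : ∀ {U V} → (∀ i → NonZero (U i)) → (∀ i → NonZero (V i)) →
    HasCycleOfType 5 4 U V → TypeParametrisation U V
  cycle⇒parametrisation {U} {V} U≉0 V≉0 (C , u≈U , v≈V) =
    parametrisation-resp (λ i → trans (sym (u-type i)) (u≈U i)) (λ i → trans (sym (v-type i)) (v≈V i))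
      (ClosedPath.closedPath⇒parametrisation closes u≉0 v≉0)
    where
    open CycleAsPath C
    u≉0 : ∀ i → NonZero (u i)
    u≉0 i uᵢ≈0 = U≉0 i (trans (sym (u≈U i)) (trans (u-type i) uᵢ≈0))
    v≉0 : ∀ i → NonZero (v i)
    v≉0 i vᵢ≈0 = V≉0 i (trans (sym (v≈V i)) (trans (v-type i) vᵢ≈0))

theorem3 : (q : ℕ) → IsPrimePower q → (F : FiniteField q) →
    let open Lambda F in
    (u v : Fin 5 → Carrier) →
    (∀ i → NonZero (u i)) → (∀ i → NonZero (v i)) →
    HasCycleOfType 5 4 u v ⇔
    Σ Carrier λ a → Σ Carrier λ b → Σ Carrier λ c → Σ Carrier λ d → Σ Carrier λ r →
      NonZero a × NonZero b × NonZero c × NonZero d × NonZero r ×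
      ((c * a * a) + (c * ((b + b) + c) * a) + (b * (c + d) * (b + c + d))) ≈ 0# ×
      NonZero (a + b + c + d) ×
      v zero ≈ a × v (suc zero) ≈ b × v (suc (suc zero)) ≈ c ×
      v (suc (suc (suc zero))) ≈ d × v (suc (suc (suc (suc zero)))) ≈ - (a + b + c + d) ×
      u zero ≈ c * r × u (suc zero) ≈ d * r × u (suc (suc zero)) ≈ - (a + b + c + d) * r ×
      u (suc (suc (suc zero))) ≈ a * r × u (suc (suc (suc (suc zero)))) ≈ b * r
theorem3 _ _ F u v u≉0 v≉0 = mk⇔ (cycle⇒parametrisation u≉0 v≉0) parametrisation⇒cycle
  where open TenCycles F
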